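{- Let $\lambda\in\mathbb{F}_{q^n}\setminus\mathbb{F}_q$ with $\mathbb{F}_q(\lambda)=\mathbb{F}_{q^n}$, let $1\le t\le n-1$, let \[L=\{\langle(\alpha_0+\alpha_1\lambda+\dots+\alpha_{t-1}\lambda^{t-1},\ \beta_0+\dots+\beta_{n-t-1}\lambda^{n-t-1})\rangle_{\mathbb{F}_{q^n}}\colon \alpha_i,\beta_i\in\mathbb{F}_q\text{ not all zero}\},\] and let $p(x)=\sum_{i=t}^{n-1}\lambda^i\mathrm{Tr}_{q^n/q}((\lambda^i)^*x)=\sum_{j=0}^{n-1}A_jx^{q^j}$, where $((\lambda^i)^*)_i$ is the dual basis of $(1,\lambda,\dots,\lambda^{n-1})$ (so $L$ is $\mathrm{PGL}(2,q^n)$-equivalent to $L_p=\{\langle(x,p(x))\rangle_{\mathbb{F}_{q^n}}\colon x\in\mathbb{F}_{q^n}^*\}$). Then: (1) If $x^n-d\in\mathbb{F}_q[x]$ is the minimal polynomial of $\lambda$ over $\mathbb{F}_q$, then $A_j=\frac1n\sum_{i=t}^{n-1}\lambda^{i(1-q^j)}$. (2) If $x^n-cx^k-1\in\mathbb{F}_q[x]$ (with $1\le k\le n-1$) is the minimal polynomial of $\lambda$ over $\mathbb{F}_q$, then \[A_j=\frac{ -c+\lambda^{q^j(n-k)}}{n\lambda^{q^j(n-1)}-ck\lambda^{q^j(k-1)}}\Big(\sum_{i=t}^{k-1}\lambda^{i+q^j(k-i-1)}+\sum_{i=k}^{n-1}\lambda^{i+q^j(n+k-i-1)}\Big)\] if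 $t<k$, and \[A_j=\frac{ -c+\lambda^{q^j(n-k)}}{n\lambda^{q^j(n-1)}-ck\lambda^{q^j(k-1)}}\sum_{i=t}^{n-1}\lambda^{i+q^j(n+k-i-1)}\] if $t\ge k$.
   Context: $\mathrm{Tr}_{q^n/q}(a)=\sum_{i=0}^{n-1}a^{q^i}$. Two ordered $\mathbb{F}_q$-bases $(\xi_i)$, $(\xi_i^*)$ of $\mathbb{F}_{q^n}$ are dual if $\mathrm{Tr}_{q^n/q}(\xi_i\xi_j^*)=\delta_{ij}$. -}

module Defs where

open import Level using (_⊔_)
open import Algebra.Bundles using (CommutativeRing; Semiring)
open import Data.Nat using (ℕ; zero; suc; _<_; _∸_; _≡ᵇ_) renaming (_^_ to _^ℕ_)
open import Data.Fin using (Fin)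
open import Data.Bool using (if_then_else_)
open import Data.Product using (Σ; ∃; _×_)
open import Relation.Nullary using (¬_)
open import Relation.Binary.PropositionalEquality using (_≡_)

-- Elementary finite-field theory over an arbitrary commutative ring R
-- (which the hypotheses below force to be a finite field).
module FieldTheory {a ℓ} (R : CommutativeRing a ℓ) where
  open CommutativeRing R
  open import Algebra.Definitions.RawSemiring (Semiring.rawSemiring semiring) public using (_^_) renaming (_×_ to _·_)

  -- R is a field, with inverse operation inv (value at 0 irrelevant)
  record IsField (inv : Carrier → Carrier) : Set (a ⊔ ℓ) where
    field
      1≉0     : ¬ (1# ≈ 0#)
      inverse : ∀ x → ¬ (x ≈ 0#) → x * inv x ≈ 1#

  HasCard : ℕ → Set (a ⊔ ℓ)
  HasCard N = Σ (Fin N → Carrier) λ e →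
    (∀ x → ∃ λ i → e i ≈ x) × (∀ i j → e i ≈ e j → i ≡ j)

  sumFrom : ℕ → ℕ → (ℕ → Carrier) → Carrier
  sumFrom s zero    f = 0#
  sumFrom s (suc m) f = f s + sumFrom (suc s) m f

  -- Σ_{i = lo}^{hi - 1} f i   (empty if hi ≤ lo)
  sumRange : ℕ → ℕ → (ℕ → Carrier) → Carrier
  sumRange lo hi f = sumFrom lo (hi ∸ lo) f

  InFq : ℕ → Carrier → Set ℓ
  InFq q x = x ^ q ≈ x

  Tr : ℕ → ℕ → Carrier → Carrier
  Tr q n x = sumRange 0 n (λ i → x ^ (q ^ℕ i))

  kron : ℕ → ℕ → Carrier
  kron i j = if i ≡ᵇ j then 1# else 0#

  IsDualBasis : ℕ → ℕ → (ℕ → Carrier) → (ℕ → Carrier) → Set ℓ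
  IsDualBasis q n b b* = ∀ i j → i < n → j < n → Tr q n (b i * b* j) ≈ kron i j

  IsMinimalPolynomial : ℕ → ℕ → Carrier → (ℕ → Carrier) → Set (a ⊔ ℓ)
  IsMinimalPolynomial q n θ c =
    (∀ i → i < n → InFq q (c i)) ×
    (θ ^ n + sumRange 0 n (λ i → c i * θ ^ i) ≈ 0#) ×
    (∀ (b : ℕ → Carrier) → (∀ i → i < n → InFq q (b i)) →
       sumRange 0 n (λ i → b i * θ ^ i) ≈ 0# → ∀ i → i < n → b i ≈ 0#)

  -- lower coefficients of x^n - d
  binomialCoeffs : Carrier → ℕ → Carrier
  binomialCoeffs d i = if i ≡ᵇ 0 then - d else 0#

  -- lower coefficients of x^n - c x^k - 1   (k ≥ 1)
  trinomialCoeffs : Carrier → ℕ → ℕ → Carrier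
  trinomialCoeffs c k i = if i ≡ᵇ 0 then - 1# else (if i ≡ᵇ k then - c else 0#)

  pPoly : ℕ → ℕ → ℕ → Carrier → (ℕ → Carrier) → Carrier → Carrier
  pPoly q n t θ μ x = sumRange t n (λ i → θ ^ i * Tr q n (μ i * x))

  linPoly : ℕ → ℕ → (ℕ → Carrier) → Carrier → Carrier
  linPoly q n A x = sumRange 0 n (λ j → A j * x ^ (q ^ℕ j))

-- Over a field with q^n elements, x ↦ x^q is additive, because q must be a power of the characteristic
-- p, and (x + y)^p = x^p + y^p. Therefore the conjugates θ^(q^j) (j < n) are roots of the minimal
-- polynomial F of θ. Writing Tr as a sum of powers, duality turns into the identity
-- P_l = Σ_j (μ_l)^(q^j) P(θ^(q^j)), valid for every polynomial P of degree < n. Applied to a product of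
-- linear factors, this identity shows that the conjugates are pairwise distinct. Applied to
-- (F(x) - F(y))/(x - y) with y = θ^(q^j), it gives Euler's formula
-- (μ_l)^(q^j) = [x^l]((F(x) - F(y))/(x - y)) / F′(y). For the trinomial F = x^n - c x^k - d we
-- substitute this into p(x) = Σ_j (Σ_i θ^i (μ_i)^(q^j)) x^(q^j) and simplify with F(θ^(q^j)) = 0 to get
-- A_j. Case (1) is the trinomial with c = 0, k = 1.
module Submission where

open import Defs
open import Algebra.Bundles using (CommutativeRing)
open import Data.Nat using (ℕ; _≤_; _<_; _∸_) renaming (_+_ to _+ℕ_; _*_ to _*ℕ_; _^_ to _^ℕ_)
open import Data.Product using (_×_)
open import Relation.Nullary using (¬_)

open import Data.Bool using (Bool; true; false; T; if_then_else_)
open import Data.Bool.Properties using (T-≡)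
open import Data.Fin as Fin using (Fin; toℕ)
import Data.Fin.Properties as Fin
open import Data.Nat using (zero; suc; z≤n; s≤s; NonZero; _<ᵇ_; _≡ᵇ_)
import Data.Nat as ℕ
import Data.Nat.Properties as ℕ
open import Data.Nat.Combinatorics using (_C_)
open import Data.Nat.Divisibility using (_∣_; divides; quotient; quotient-<; m∣n⇒n≡quotient*m)
open import Data.Nat.Primality using (Prime; prime?; ¬prime⇒composite; composite; prime⇒nonZero; prime⇒nonTrivial)
open import Data.Product using (∃; _,_; proj₁; proj₂)
open import Function using (_∘_; Equivalence)
open import Level using (_⊔_)
open import Relation.Binary.Definitions using (tri<; tri≈; tri>)
open import Relation.Binary.PropositionalEquality as ≡ using (_≡_; _≢_)
open import Relation.Nullary using (Dec; yes; no; contradiction)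

-- For an abstract commutative ring the standard library's solvers take their coefficients either from
-- the ring itself, where they cannot be compared (1 - 1 is not syntactically 0), or from ℕ, which has
-- no negation. This instance uses integer coefficients, interpreted through the canonical map ℤ → R.
module IntegerCoefficientSolver {a ℓ} (R : CommutativeRing a ℓ) where
  open CommutativeRing R
  open import Algebra.Properties.Ring ring using (-0#≈0#; -‿involutive; -‿+-comm; -1*x≈-x)
  open import Algebra.Properties.CommutativeSemigroup +-commutativeSemigroup
    using () renaming (interchange to +-interchange)
  open import Algebra.Properties.CommutativeSemigroup *-commutativeSemigroup
    using () renaming (interchange to *-interchange)
  open import Algebra.Properties.Semiring.Mult semiring using (×-homo-+; ×1-homo-*) renaming (_×_ to _·_)
  open import Algebra.Properties.Semiring.Exp.TCOptimised semiring using (^-congˡ)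
  open import Data.Integer as ℤ using (ℤ; +_; -[1+_]; _⊖_; _◃_; sign; ∣_∣)
  import Data.Integer.Properties as ℤ
  open import Data.Maybe using (nothing)
  open import Data.Sign as Sign using (Sign)
  open import Data.Vec using (Vec)
  open import Relation.Binary.Reasoning.Setoid setoid
  open import Tactic.RingSolver.Core.AlmostCommutativeRing using (fromCommutativeRing)
  open import Tactic.RingSolver.Core.Polynomial.Parameters using (Homomorphism)
  open import Tactic.RingSolver.Core.Expression public

  ⟦_⟧ℤ : ℤ → Carrier
  ⟦ + n ⟧ℤ      = n · 1#
  ⟦ -[1+ n ] ⟧ℤ = - (suc n · 1#)

  ⊖-homo : ∀ m n → ⟦ m ⊖ n ⟧ℤ ≈ m · 1# - n · 1#
  ⊖-homo m zero = begin
    ⟦ m ⊖ 0 ⟧ℤ   ≡⟨ ≡.cong ⟦_⟧ℤ (ℤ.⊖-≥ {m} {0} z≤n) ⟩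
    m · 1#       ≈⟨ +-identityʳ _ ⟨
    m · 1# + 0#  ≈⟨ +-congˡ -0#≈0# ⟨
    m · 1# - 0#  ∎
  ⊖-homo zero (suc n) = sym (+-identityˡ _)
  ⊖-homo (suc m) (suc n) = begin
    ⟦ suc m ⊖ suc n ⟧ℤ    ≡⟨ ≡.cong ⟦_⟧ℤ (ℤ.[1+m]⊖[1+n]≡m⊖n m n) ⟩
    ⟦ m ⊖ n ⟧ℤ            ≈⟨ ⊖-homo m n ⟩
    x - y                 ≈⟨ +-identityˡ _ ⟨
    0# + (x - y)          ≈⟨ +-congʳ (-‿inverseʳ 1#) ⟨
    (1# - 1#) + (x - y)   ≈⟨ +-interchange 1# (- 1#) x (- y) ⟩
    (1# + x) + (- 1# - y) ≈⟨ +-congˡ (-‿+-comm 1# y) ⟩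
    (1# + x) - (1# + y)   ∎
    where
    x y : Carrier
    x = m · 1#
    y = n · 1#

  ⟦_⟧± : Sign → Carrier
  ⟦ Sign.+ ⟧± = 1#
  ⟦ Sign.- ⟧± = - 1#

  ◃-homo : ∀ s n → ⟦ s ◃ n ⟧ℤ ≈ ⟦ s ⟧± * (n · 1#)
  ◃-homo Sign.+ zero    = sym (zeroʳ _)
  ◃-homo Sign.- zero    = sym (zeroʳ _)
  ◃-homo Sign.+ (suc n) = sym (*-identityˡ _)
  ◃-homo Sign.- (suc n) = sym (-1*x≈-x _)

  sign-abs-homo : ∀ i → ⟦ i ⟧ℤ ≈ ⟦ sign i ⟧± * (∣ i ∣ · 1#)
  sign-abs-homo (+ n)    = sym (*-identityˡ _)
  sign-abs-homo -[1+ n ] = sym (-1*x≈-x _)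

  sign-*-homo : ∀ s t → ⟦ s Sign.* t ⟧± ≈ ⟦ s ⟧± * ⟦ t ⟧±
  sign-*-homo Sign.+ _      = sym (*-identityˡ _)
  sign-*-homo Sign.- Sign.+ = sym (*-identityʳ _)
  sign-*-homo Sign.- Sign.- = begin
    1#          ≈⟨ -‿involutive 1# ⟨
    - - 1#      ≈⟨ -1*x≈-x _ ⟨
    - 1# * - 1# ∎

  +-homo : ∀ i j → ⟦ i ℤ.+ j ⟧ℤ ≈ ⟦ i ⟧ℤ + ⟦ j ⟧ℤ
  +-homo (+ m)    (+ n)    = ×-homo-+ 1# m n
  +-homo (+ m)    -[1+ n ] = ⊖-homo m (suc n)
  +-homo -[1+ m ] (+ n)    = trans (⊖-homo n (suc m)) (+-comm _ _)
  +-homo -[1+ m ] -[1+ n ] = begin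
    - (suc (suc (m +ℕ n)) · 1#)   ≡⟨ ≡.cong (λ k → - (suc k · 1#)) (≡.sym (ℕ.+-suc m n)) ⟩
    - ((suc m +ℕ suc n) · 1#)     ≈⟨ -‿cong (×-homo-+ 1# (suc m) (suc n)) ⟩
    - (suc m · 1# + suc n · 1#)   ≈⟨ -‿+-comm _ _ ⟨
    - (suc m · 1#) - suc n · 1#   ∎

  *-homo : ∀ i j → ⟦ i ℤ.* j ⟧ℤ ≈ ⟦ i ⟧ℤ * ⟦ j ⟧ℤ
  *-homo i j = begin
    ⟦ (sign i Sign.* sign j) ◃ (∣ i ∣ *ℕ ∣ j ∣) ⟧ℤ
      ≈⟨ ◃-homo (sign i Sign.* sign j) (∣ i ∣ *ℕ ∣ j ∣) ⟩
    ⟦ sign i Sign.* sign j ⟧± * ((∣ i ∣ *ℕ ∣ j ∣) · 1#)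
      ≈⟨ *-cong (sign-*-homo (sign i) (sign j)) (×1-homo-* ∣ i ∣ ∣ j ∣) ⟩
    (⟦ sign i ⟧± * ⟦ sign j ⟧±) * ((∣ i ∣ · 1#) * (∣ j ∣ · 1#))
      ≈⟨ *-interchange _ _ _ _ ⟩
    (⟦ sign i ⟧± * (∣ i ∣ · 1#)) * (⟦ sign j ⟧± * (∣ j ∣ · 1#))
      ≈⟨ *-cong (sign-abs-homo i) (sign-abs-homo j) ⟨
    ⟦ i ⟧ℤ * ⟦ j ⟧ℤ ∎

  -‿homo : ∀ i → ⟦ ℤ.- i ⟧ℤ ≈ - ⟦ i ⟧ℤ
  -‿homo -[1+ n ]  = sym (-‿involutive _)
  -‿homo (+ zero)  = sym -0#≈0#
  -‿homo (+ suc n) = refl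

  isZero : ℤ → Bool
  isZero (+ zero) = true
  isZero _        = false

  isZero-sound : ∀ i → T (isZero i) → 0# ≈ ⟦ i ⟧ℤ
  isZero-sound (+ zero) _ = refl

  homomorphism : Homomorphism _ _ a ℓ
  homomorphism = record
    { from = record { rawRing = ℤ.+-*-rawRing ; isZero = isZero }
    ; to = fromCommutativeRing R (λ _ → nothing)
    ; morphism = record
      { ⟦_⟧ = ⟦_⟧ℤ ; +-homo = +-homo ; *-homo = *-homo ; -‿homo = -‿homo
      ; 0-homo = refl ; 1-homo = +-identityʳ 1# }
    ; Zero-C⟶Zero-R = isZero-sound
    }

  open Eval rawRing ⟦_⟧ℤ public
  open import Tactic.RingSolver.Core.Polynomial.Base (Homomorphism.from homomorphism)
  open import Tactic.RingSolver.Core.Polynomial.Semantics homomorphism using () renaming (⟦_⟧ to ⟦_⟧ₚ)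
  open import Tactic.RingSolver.Core.Polynomial.Homomorphism homomorphism
    using (κ-hom; ι-hom; ⊞-hom; ⊠-hom; ⊟-hom; ⊡-hom)

  norm : ∀ {n} → Expr ℤ n → Poly n
  norm (Κ x)   = κ x
  norm (Ι x)   = ι x
  norm (x ⊕ y) = norm x ⊞ norm y
  norm (x ⊗ y) = norm x ⊠ norm y
  norm (⊝ x)   = ⊟ norm x
  norm (x ⊛ i) = norm x ⊡ i

  ⟦_⇓⟧ : ∀ {n} → Expr ℤ n → Vec Carrier n → Carrier
  ⟦ e ⇓⟧ = ⟦ norm e ⟧ₚ

  correct : ∀ {n} (e : Expr ℤ n) ρ → ⟦ e ⇓⟧ ρ ≈ ⟦ e ⟧ ρ
  correct (Κ x)   ρ = κ-hom x ρ
  correct (Ι x)   ρ = ι-hom x ρ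
  correct (x ⊕ y) ρ = trans (⊞-hom (norm x) (norm y) ρ) (+-cong (correct x ρ) (correct y ρ))
  correct (x ⊗ y) ρ = trans (⊠-hom (norm x) (norm y) ρ) (*-cong (correct x ρ) (correct y ρ))
  correct (⊝ x)   ρ = trans (⊟-hom (norm x) ρ) (-‿cong (correct x ρ))
  correct (x ⊛ i) ρ = trans (⊡-hom (norm x) i ρ) (^-congˡ i (correct x ρ))

  open import Relation.Binary.Reflection setoid Ι ⟦_⟧ ⟦_⇓⟧ correct public using (solve; _⊜_)

module PrimeDivisibility where
  open import Data.Nat
  open import Data.Nat.Properties
  open import Data.Nat.Coprimality using (Coprime; coprime-divisor)
  open import Data.Nat.Combinatorics using (k![n∸k]!∣n!)
  open import Data.Nat.Combinatorics.Specification using (nCk≡n!/k![n-k]!)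
  open import Data.Nat.Divisibility
  open import Data.Nat.Primality
  open import Data.Sum using (inj₁; inj₂)
  open import Relation.Binary.PropositionalEquality

  prime∤⇒coprime : ∀ {p d} → Prime p → ¬ p ∣ d → Coprime d p
  prime∤⇒coprime p-prime p∤d (i∣d , i∣p) with prime⇒irreducible p-prime i∣p
  ... | inj₁ i≡1  = i≡1
  ... | inj₂ refl = contradiction i∣d p∤d

  d∣p^k⇒d≡p^m : ∀ {p d} → Prime p → ∀ k → d ∣ p ^ k → ∃ λ m → d ≡ p ^ m
  d∣p^k⇒d≡p^m p-prime zero d∣1 = 0 , ∣1⇒≡1 d∣1
  d∣p^k⇒d≡p^m {p} {d} p-prime (suc k) d∣p^[1+k] with p ∣? d
  ... | no p∤d = d∣p^k⇒d≡p^m p-prime k (coprime-divisor (prime∤⇒coprime p-prime p∤d) d∣p^[1+k])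
  ... | yes (divides e refl) =
    let instance _ = prime⇒nonZero p-prime
        (m , e≡p^m) = d∣p^k⇒d≡p^m p-prime k (*-cancelʳ-∣ p (subst (e * p ∣_) (*-comm p (p ^ k)) d∣p^[1+k]))
    in suc m , trans (*-comm e p) (cong (p *_) e≡p^m)

  m∣m^n : ∀ m n → .{{NonZero n}} → m ∣ m ^ n
  m∣m^n m (suc n) = m∣m*n (m ^ n)

  n∣n! : ∀ n → .{{NonZero n}} → n ∣ n !
  n∣n! (suc n) = m∣m*n (n !)

  p∤m! : ∀ {p} → Prime p → ∀ m → m < p → ¬ p ∣ m !
  p∤m! p-prime zero    _   p∣1  = ¬prime[1] (subst Prime (∣1⇒≡1 p∣1) p-prime)
  p∤m! p-prime (suc m) m<p p∣m! with euclidsLemma (suc m) (m !) p-prime p∣m!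
  ... | inj₁ p∣1+m = >⇒∤ m<p p∣1+m
  ... | inj₂ p∣m!′ = p∤m! p-prime m (<-trans (n<1+n m) m<p) p∣m!′

  p∣pCk : ∀ {p} → Prime p → ∀ k → 0 < k → k < p → p ∣ p C k
  p∣pCk {p} p-prime k 0<k k<p with euclidsLemma (p C k) (k ! * (p ∸ k) !) p-prime p∣pCk*k![p∸k]!
    where
    k![p∸k]!∣p! : k ! * (p ∸ k) ! ∣ p !
    k![p∸k]!∣p! = k![n∸k]!∣n! {p} {k} (<⇒≤ k<p)
    pCk≡quotient : p C k ≡ quotient k![p∸k]!∣p!
    pCk≡quotient = trans (nCk≡n!/k![n-k]! (<⇒≤ k<p)) (n/m≡quotient k![p∸k]!∣p! {{k !* (p ∸ k) !≢0}})
    p∣pCk*k![p∸k]! : p ∣ (p C k) * (k ! * (p ∸ k) !)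
    p∣pCk*k![p∸k]! = subst (p ∣_)
      (trans (m∣n⇒n≡quotient*m k![p∸k]!∣p!) (cong (_* (k ! * (p ∸ k) !)) (sym pCk≡quotient)))
      (n∣n! p {{prime⇒nonZero p-prime}})
  ... | inj₁ p∣pCk = p∣pCk
  ... | inj₂ p∣k!*[p∸k]! with euclidsLemma (k !) ((p ∸ k) !) p-prime p∣k!*[p∸k]!
  ...   | inj₁ p∣k!     = contradiction p∣k! (p∤m! p-prime k k<p)
  ...   | inj₂ p∣[p∸k]! = contradiction p∣[p∸k]! (p∤m! p-prime (p ∸ k) (∸-monoʳ-< {p} {k} 0<k (<⇒≤ k<p)))

¬T⇒≡false : ∀ {b} → ¬ T b → b ≡ false
¬T⇒≡false {false} _  = ≡.refl
¬T⇒≡false {true}  ¬t = contradiction _ ¬t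

<⇒<ᵇ≡true : ∀ {l k} → l < k → (l <ᵇ k) ≡ true
<⇒<ᵇ≡true l<k = Equivalence.to T-≡ (ℕ.<⇒<ᵇ l<k)

≤⇒<ᵇ≡false : ∀ {l k} → k ≤ l → (l <ᵇ k) ≡ false
≤⇒<ᵇ≡false {l} {k} k≤l = ¬T⇒≡false (ℕ.≤⇒≯ k≤l ∘ ℕ.<ᵇ⇒< l k)

≡ᵇ-refl : ∀ l → (l ≡ᵇ l) ≡ true
≡ᵇ-refl l = Equivalence.to T-≡ (ℕ.≡⇒≡ᵇ l l ≡.refl)

≢⇒≡ᵇ≡false : ∀ {i l} → i ≢ l → (i ≡ᵇ l) ≡ false
≢⇒≡ᵇ≡false {i} {l} i≢l = ¬T⇒≡false (i≢l ∘ ℕ.≡ᵇ⇒≡ i l)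

<⇒≤∸1 : ∀ {k n} → k < n → k ≤ n ∸ 1
<⇒≤∸1 {k} {n} k<n = ≡.subst (k ≤_) (ℕ.pred[m∸n]≡m∸[1+n] n 0) (ℕ.<⇒≤pred k<n)

n∸1<n : ∀ {j n} → j < n → n ∸ 1 < n
n∸1<n {n = suc n} _ = ℕ.n<1+n n

∸-suc-comm : ∀ m i → m ∸ i ∸ 1 ≡ m ∸ suc i
∸-suc-comm m i = ≡.trans (ℕ.∸-+-assoc m i 1) (≡.cong (m ∸_) (ℕ.+-comm i 1))

∸-telescope : ∀ {a b c} → a ≤ b → b ≤ c → (c ∸ b) +ℕ (b ∸ a) ≡ c ∸ a
∸-telescope {a} {b} {c} a≤b b≤c =
  ≡.trans (≡.sym (ℕ.+-∸-assoc (c ∸ b) a≤b)) (≡.cong (_∸ a) (ℕ.m∸n+n≡m b≤c))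

n+k∸i∸1≡k+n∸[1+i] : ∀ {n i} k → i < n → n +ℕ k ∸ i ∸ 1 ≡ k +ℕ (n ∸ suc i)
n+k∸i∸1≡k+n∸[1+i] {n} {i} k i<n =
  ≡.trans (∸-suc-comm (n +ℕ k) i) (≡.trans (≡.cong (_∸ suc i) (ℕ.+-comm n k)) (ℕ.+-∸-assoc k i<n))

i*[m∸1]+i≡m*i : ∀ i m → .{{NonZero m}} → i *ℕ (m ∸ 1) +ℕ i ≡ m *ℕ i
i*[m∸1]+i≡m*i i (suc m) = ≡.trans (ℕ.+-comm (i *ℕ m) i) (≡.cong (i +ℕ_) (ℕ.*-comm i m))

i+[n∸[1+i]]≡n∸1 : ∀ {i n} → i < n → i +ℕ (n ∸ suc i) ≡ n ∸ 1
i+[n∸[1+i]]≡n∸1 {i} {suc n} (s≤s i≤n) = ℕ.m+[n∸m]≡n i≤n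

module Sums {a ℓ} (R : CommutativeRing a ℓ) where
  open CommutativeRing R
  open FieldTheory R using (sumFrom; sumRange)
  open import Algebra.Properties.Ring ring using (-0#≈0#; -‿+-comm)
  open import Algebra.Properties.CommutativeSemigroup +-commutativeSemigroup
    using () renaming (interchange to +-interchange)
  open import Relation.Binary.Reasoning.Setoid setoid

  private
    <[1+s]+m⇒<s+[1+m] : ∀ {s m i} → i < suc s +ℕ m → i < s +ℕ suc m
    <[1+s]+m⇒<s+[1+m] {s} {m} {i} = ≡.subst (i <_) (≡.sym (ℕ.+-suc s m))

  sumFrom-cong-on : ∀ s m {f g : ℕ → Carrier} → (∀ i → s ≤ i → i < s +ℕ m → f i ≈ g i) →
                    sumFrom s m f ≈ sumFrom s m g
  sumFrom-cong-on s zero    f≈g = refl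
  sumFrom-cong-on s (suc m) f≈g = +-cong (f≈g s ℕ.≤-refl (ℕ.m<m+n s (s≤s z≤n)))
    (sumFrom-cong-on (suc s) m (λ i s<i i< → f≈g i (ℕ.<⇒≤ s<i) (<[1+s]+m⇒<s+[1+m] i<)))

  sumFrom-cong : ∀ s m {f g : ℕ → Carrier} → (∀ i → f i ≈ g i) → sumFrom s m f ≈ sumFrom s m g
  sumFrom-cong s m f≈g = sumFrom-cong-on s m (λ i _ _ → f≈g i)

  sumFrom-zero : ∀ s m {f : ℕ → Carrier} → (∀ i → s ≤ i → i < s +ℕ m → f i ≈ 0#) → sumFrom s m f ≈ 0#
  sumFrom-zero s zero    f≈0 = refl
  sumFrom-zero s (suc m) {f} f≈0 = begin
    sumFrom s (suc m) f               ≈⟨ sumFrom-cong-on s (suc m) f≈0 ⟩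
    0# + sumFrom (suc s) m (λ _ → 0#) ≈⟨ +-identityˡ _ ⟩
    sumFrom (suc s) m (λ _ → 0#)      ≈⟨ sumFrom-zero (suc s) m (λ _ _ _ → refl) ⟩
    0#                                ∎

  sumFrom-homo : (φ : Carrier → Carrier) → φ 0# ≈ 0# → (∀ x y → φ (x + y) ≈ φ x + φ y) →
                 ∀ s m (f : ℕ → Carrier) → φ (sumFrom s m f) ≈ sumFrom s m (φ ∘ f)
  sumFrom-homo φ φ-0 φ-+ s zero    f = φ-0
  sumFrom-homo φ φ-0 φ-+ s (suc m) f = trans (φ-+ _ _) (+-congˡ (sumFrom-homo φ φ-0 φ-+ (suc s) m f))

  *-distribˡ-sumFrom : ∀ c s m (f : ℕ → Carrier) → c * sumFrom s m f ≈ sumFrom s m (λ i → c * f i)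
  *-distribˡ-sumFrom c = sumFrom-homo (c *_) (zeroʳ c) (distribˡ c)

  *-distribʳ-sumFrom : ∀ c s m (f : ℕ → Carrier) → sumFrom s m f * c ≈ sumFrom s m (λ i → f i * c)
  *-distribʳ-sumFrom c = sumFrom-homo (_* c) (zeroˡ c) (distribʳ c)

  -‿distrib-sumFrom : ∀ s m (f : ℕ → Carrier) → - sumFrom s m f ≈ sumFrom s m (λ i → - f i)
  -‿distrib-sumFrom = sumFrom-homo -_ -0#≈0# (λ x y → sym (-‿+-comm x y))

  sumFrom-distrib-+ : ∀ s m (f g : ℕ → Carrier) →
                      sumFrom s m (λ i → f i + g i) ≈ sumFrom s m f + sumFrom s m g
  sumFrom-distrib-+ s zero    f g = sym (+-identityʳ 0#)
  sumFrom-distrib-+ s (suc m) f g =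
    trans (+-congˡ (sumFrom-distrib-+ (suc s) m f g)) (+-interchange (f s) (g s) _ _)

  sumFrom-comm : ∀ s m s′ m′ (f : ℕ → ℕ → Carrier) →
    sumFrom s m (λ i → sumFrom s′ m′ (f i)) ≈ sumFrom s′ m′ (λ j → sumFrom s m (λ i → f i j))
  sumFrom-comm s zero    s′ m′ f = sym (sumFrom-zero s′ m′ (λ _ _ _ → refl))
  sumFrom-comm s (suc m) s′ m′ f = begin
    sumFrom s′ m′ (f s) + sumFrom (suc s) m (λ i → sumFrom s′ m′ (f i))
      ≈⟨ +-congˡ (sumFrom-comm (suc s) m s′ m′ f) ⟩
    sumFrom s′ m′ (f s) + sumFrom s′ m′ (λ j → sumFrom (suc s) m (λ i → f i j))
      ≈⟨ sumFrom-distrib-+ s′ m′ _ _ ⟨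
    sumFrom s′ m′ (λ j → f s j + sumFrom (suc s) m (λ i → f i j)) ∎

  sumFrom-split : ∀ s m m′ (f : ℕ → Carrier) →
                  sumFrom s (m +ℕ m′) f ≈ sumFrom s m f + sumFrom (s +ℕ m) m′ f
  sumFrom-split s zero m′ f rewrite ℕ.+-identityʳ s = sym (+-identityˡ _)
  sumFrom-split s (suc m) m′ f rewrite ℕ.+-suc s m =
    trans (+-congˡ (sumFrom-split (suc s) m m′ f)) (sym (+-assoc _ _ _))

  sumFrom-snoc : ∀ s m (f : ℕ → Carrier) → sumFrom s (suc m) f ≈ sumFrom s m f + f (s +ℕ m)
  sumFrom-snoc s m f = begin
    sumFrom s (suc m) f                ≡⟨ ≡.cong (λ k → sumFrom s k f) (ℕ.+-comm 1 m) ⟩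
    sumFrom s (m +ℕ 1) f               ≈⟨ sumFrom-split s m 1 f ⟩
    sumFrom s m f + (f (s +ℕ m) + 0#)  ≈⟨ +-congˡ (+-identityʳ _) ⟩
    sumFrom s m f + f (s +ℕ m)         ∎

  sumFrom-single : ∀ s m j (f : ℕ → Carrier) → s ≤ j → j < s +ℕ m →
                   (∀ i → s ≤ i → i < s +ℕ m → i ≢ j → f i ≈ 0#) → sumFrom s m f ≈ f j
  sumFrom-single s zero j f s≤j j<s+0 _ =
    contradiction (≡.subst (j <_) (ℕ.+-identityʳ s) j<s+0) (ℕ.≤⇒≯ s≤j)
  sumFrom-single s (suc m) j f s≤j j< f≈0 with s ℕ.≟ j
  ... | yes ≡.refl = trans (+-congˡ (sumFrom-zero (suc s) m
          (λ i s<i i< → f≈0 i (ℕ.<⇒≤ s<i) (<[1+s]+m⇒<s+[1+m] i<) (ℕ.>⇒≢ s<i)))) (+-identityʳ _)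
  ... | no s≢j = trans (+-cong (f≈0 s ℕ.≤-refl (ℕ.m<m+n s (s≤s z≤n)) s≢j)
          (sumFrom-single (suc s) m j f (ℕ.≤∧≢⇒< s≤j s≢j) (≡.subst (j <_) (ℕ.+-suc s m) j<)
            (λ i s<i i< → f≈0 i (ℕ.<⇒≤ s<i) (<[1+s]+m⇒<s+[1+m] i<))))
          (+-identityˡ _)

  sumRange-cong-on : ∀ lo hi {f g : ℕ → Carrier} → lo ≤ hi → (∀ i → lo ≤ i → i < hi → f i ≈ g i) →
                     sumRange lo hi f ≈ sumRange lo hi g
  sumRange-cong-on lo hi lo≤hi f≈g = sumFrom-cong-on lo (hi ∸ lo)
    (λ i lo≤i i< → f≈g i lo≤i (≡.subst (i <_) (ℕ.m+[n∸m]≡n lo≤hi) i<))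

  sumRange-split : ∀ lo mid hi (f : ℕ → Carrier) → lo ≤ mid → mid ≤ hi →
                   sumRange lo hi f ≈ sumRange lo mid f + sumRange mid hi f
  sumRange-split lo mid hi f lo≤mid mid≤hi = begin
    sumFrom lo (hi ∸ lo) f
      ≡⟨ ≡.cong (λ m → sumFrom lo m f) hi∸lo≡ ⟩
    sumFrom lo ((mid ∸ lo) +ℕ (hi ∸ mid)) f
      ≈⟨ sumFrom-split lo (mid ∸ lo) (hi ∸ mid) f ⟩
    sumFrom lo (mid ∸ lo) f + sumFrom (lo +ℕ (mid ∸ lo)) (hi ∸ mid) f
      ≡⟨ ≡.cong (λ s → sumFrom lo (mid ∸ lo) f + sumFrom s (hi ∸ mid) f) (ℕ.m+[n∸m]≡n lo≤mid) ⟩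
    sumFrom lo (mid ∸ lo) f + sumFrom mid (hi ∸ mid) f ∎
    where
    hi∸lo≡ : hi ∸ lo ≡ (mid ∸ lo) +ℕ (hi ∸ mid)
    hi∸lo≡ = ≡.trans (≡.cong (_∸ lo) (≡.sym (ℕ.m+[n∸m]≡n mid≤hi))) (ℕ.+-∸-comm (hi ∸ mid) lo≤mid)

module FieldLemmas {a ℓ} (R : CommutativeRing a ℓ)
  {inv : CommutativeRing.Carrier R → CommutativeRing.Carrier R} (isField : FieldTheory.IsField R inv) where
  open CommutativeRing R
  open FieldTheory.IsField isField
  open import Algebra.Properties.CommutativeSemigroup *-commutativeSemigroup
    using () renaming (interchange to *-interchange)
  open import Relation.Binary.Reasoning.Setoid setoid

  inv-cancelˡ : ∀ {x} y → ¬ x ≈ 0# → inv x * (x * y) ≈ y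
  inv-cancelˡ {x} y x≉0 = begin
    inv x * (x * y) ≈⟨ *-assoc _ _ _ ⟨
    (inv x * x) * y ≈⟨ *-congʳ (trans (*-comm _ _) (inverse x x≉0)) ⟩
    1# * y          ≈⟨ *-identityˡ y ⟩
    y               ∎

  x*y≈0⇒y≈0 : ∀ {x y} → x * y ≈ 0# → ¬ x ≈ 0# → y ≈ 0#
  x*y≈0⇒y≈0 {x} {y} xy≈0 x≉0 = trans (sym (inv-cancelˡ y x≉0)) (trans (*-congˡ xy≈0) (zeroʳ _))

  *-nonzero : ∀ {x y} → ¬ x ≈ 0# → ¬ y ≈ 0# → ¬ x * y ≈ 0#
  *-nonzero x≉0 y≉0 xy≈0 = y≉0 (x*y≈0⇒y≈0 xy≈0 x≉0)

  inverse-unique : ∀ {x y} → ¬ x ≈ 0# → x * y ≈ 1# → y ≈ inv x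
  inverse-unique {x} {y} x≉0 xy≈1 = begin
    y               ≈⟨ inv-cancelˡ y x≉0 ⟨
    inv x * (x * y) ≈⟨ *-congˡ xy≈1 ⟩
    inv x * 1#      ≈⟨ *-identityʳ _ ⟩
    inv x           ∎

  inv-cong : ∀ {x y} → ¬ x ≈ 0# → x ≈ y → inv x ≈ inv y
  inv-cong {x} x≉0 x≈y = inverse-unique (x≉0 ∘ trans x≈y) (trans (*-congʳ (sym x≈y)) (inverse x x≉0))

  inv-distrib-* : ∀ {x y} → ¬ x ≈ 0# → ¬ y ≈ 0# → inv (x * y) ≈ inv x * inv y
  inv-distrib-* {x} {y} x≉0 y≉0 = sym (inverse-unique (*-nonzero x≉0 y≉0) (begin
    (x * y) * (inv x * inv y) ≈⟨ *-interchange _ _ _ _ ⟩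
    (x * inv x) * (y * inv y) ≈⟨ *-cong (inverse x x≉0) (inverse y y≉0) ⟩
    1# * 1#                   ≈⟨ *-identityʳ 1# ⟩
    1#                        ∎))

module AdditivePowers {a ℓ} (R : CommutativeRing a ℓ) where
  open CommutativeRing R
  open FieldTheory R
  open import Algebra.Properties.Ring ring using (-‿involutive)
  open import Algebra.Properties.Semiring.Exp semiring using (^-congˡ; ^-assocʳ)
  open import Relation.Binary.Reasoning.Setoid setoid
  open IntegerCoefficientSolver R using (solve; _⊜_; _⊕_; ⊝_)

  IsAdditivePower : ℕ → Set (a ⊔ ℓ)
  IsAdditivePower e = ∀ x y → (x + y) ^ e ≈ x ^ e + y ^ e

  freshmans-dream : ∀ n → .{{NonZero n}} → (∀ k → 0 < k → k < n → ∀ z → (n C k) · z ≈ 0#) →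
                    IsAdditivePower n
  freshmans-dream (suc m) inner≈0 x y = begin
    (x + y) ^ suc m
      ≈⟨ theorem (suc m) x y ⟩
    term Fin.zero + sum (term ∘ Fin.suc)
      ≈⟨ +-cong T₀≈yⁿ (trans (sum-init-last (term ∘ Fin.suc)) (+-cong inner-sum≈0 Tₙ≈xⁿ)) ⟩
    y ^ suc m + (0# + x ^ suc m)
      ≈⟨ +-congˡ (+-identityˡ _) ⟩
    y ^ suc m + x ^ suc m
      ≈⟨ +-comm _ _ ⟩
    x ^ suc m + y ^ suc m ∎
    where
    open import Algebra.Properties.CommutativeSemiring.Binomial commutativeSemiring using (theorem; binomialTerm)
    open import Algebra.Properties.Monoid.Sum +-monoid using (sum; sum-init-last; sum-cong-≋; sum-replicate-zero)
    open import Data.Nat.Combinatorics using (nCn≡1)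
    term : Fin (suc (suc m)) → Carrier
    term = binomialTerm x y (suc m)
    T₀≈yⁿ : term Fin.zero ≈ y ^ suc m
    T₀≈yⁿ = trans (+-identityʳ _) (*-identityˡ _)
    inner-sum≈0 : sum (term ∘ Fin.suc ∘ Fin.inject₁) ≈ 0#
    inner-sum≈0 = trans (sum-cong-≋ (λ i → inner≈0 (suc (toℕ (Fin.inject₁ i))) (s≤s z≤n)
      (s≤s (≡.subst (_< m) (≡.sym (Fin.toℕ-inject₁ i)) (Fin.toℕ<n i))) _)) (sum-replicate-zero m)
    Tₙ≈xⁿ : term (Fin.suc (Fin.fromℕ m)) ≈ x ^ suc m
    Tₙ≈xⁿ rewrite Fin.toℕ-fromℕ m | nCn≡1 (suc m) | ℕ.n∸n≡0 m = trans (+-identityʳ _) (*-identityʳ _)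

  additivePower-* : ∀ {e e′} → IsAdditivePower e → IsAdditivePower e′ → IsAdditivePower (e *ℕ e′)
  additivePower-* {e} {e′} e-additive e′-additive x y = begin
    (x + y) ^ (e *ℕ e′)           ≈⟨ ^-assocʳ (x + y) e e′ ⟨
    ((x + y) ^ e) ^ e′            ≈⟨ ^-congˡ e′ (e-additive x y) ⟩
    (x ^ e + y ^ e) ^ e′          ≈⟨ e′-additive _ _ ⟩
    (x ^ e) ^ e′ + (y ^ e) ^ e′   ≈⟨ +-cong (^-assocʳ x e e′) (^-assocʳ y e e′) ⟩
    x ^ (e *ℕ e′) + y ^ (e *ℕ e′) ∎

  additivePower-^ : ∀ {e} → IsAdditivePower e → ∀ j → IsAdditivePower (e ^ℕ j)
  additivePower-^     e-additive zero    x y = trans (*-identityʳ _) (sym (+-cong (*-identityʳ x) (*-identityʳ y)))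
  additivePower-^ {e} e-additive (suc j) = additivePower-* {e} {e ^ℕ j} e-additive (additivePower-^ e-additive j)

  0^e≈0 : ∀ e → .{{NonZero e}} → 0# ^ e ≈ 0#
  0^e≈0 (suc e) = zeroˡ _

  1^e≈1 : ∀ e → 1# ^ e ≈ 1#
  1^e≈1 zero    = refl
  1^e≈1 (suc e) = trans (*-identityˡ _) (1^e≈1 e)

  fixed-^ : ∀ {q x} → x ^ q ≈ x → ∀ j → x ^ (q ^ℕ j) ≈ x
  fixed-^ {q} {x} x^q≈x zero    = *-identityʳ x
  fixed-^ {q} {x} x^q≈x (suc j) = trans (sym (^-assocʳ x q (q ^ℕ j))) (trans (^-congˡ (q ^ℕ j) x^q≈x) (fixed-^ x^q≈x j))

  module _ {e : ℕ} {{e≢0 : NonZero e}} (e-additive : IsAdditivePower e) where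

    additivePower-neg : ∀ x → (- x) ^ e ≈ - (x ^ e)
    additivePower-neg x = begin
      (- x) ^ e                          ≈⟨ solve 2 (λ u v → v ⊜ (⊝ u ⊕ (u ⊕ v))) refl (x ^ e) _ ⟩
      - (x ^ e) + (x ^ e + (- x) ^ e)    ≈⟨ +-congˡ (e-additive x (- x)) ⟨
      - (x ^ e) + (x - x) ^ e            ≈⟨ +-congˡ (trans (^-congˡ e (-‿inverseʳ x)) (0^e≈0 e)) ⟩
      - (x ^ e) + 0#                     ≈⟨ +-identityʳ _ ⟩
      - (x ^ e)                          ∎

    additivePower-- : ∀ x y → (x - y) ^ e ≈ x ^ e - y ^ e
    additivePower-- x y = trans (e-additive x (- y)) (+-congˡ (additivePower-neg y))

    fixed-neg⇒fixed : ∀ {x} → (- x) ^ e ≈ - x → x ^ e ≈ x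
    fixed-neg⇒fixed {x} [-x]^e≈-x = begin
      x ^ e         ≈⟨ -‿involutive _ ⟨
      - - (x ^ e)   ≈⟨ -‿cong (additivePower-neg x) ⟨
      - (- x) ^ e   ≈⟨ -‿cong [-x]^e≈-x ⟩
      - - x         ≈⟨ -‿involutive x ⟩
      x             ∎

module Characteristic {a ℓ} (R : CommutativeRing a ℓ) where
  open CommutativeRing R
  open FieldTheory R
  open AdditivePowers R using (IsAdditivePower; freshmans-dream)
  open import Algebra.Properties.Semiring.Mult semiring using (×-homo-+; ×-assocˡ; ×-congʳ; ×-assoc-*)
  open import Data.Nat.DivMod using (_%_; _/_; m≡m%n+[m/n]*n)
  open import Relation.Binary.Reasoning.Setoid setoid
  open IntegerCoefficientSolver R using (solve; _⊜_; _⊕_; ⊝_)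

  module _ {p : ℕ} (p-prime : Prime p) (p·1≈0 : p · 1# ≈ 0#) where
    private instance
      p≢0 : NonZero p
      p≢0 = prime⇒nonZero p-prime

    p·x≈0 : ∀ x → p · x ≈ 0#
    p·x≈0 x = begin
      p · x          ≈⟨ ×-congʳ p (*-identityˡ x) ⟨
      p · (1# * x)   ≈⟨ ×-assoc-* p 1# x ⟨
      (p · 1#) * x   ≈⟨ *-congʳ p·1≈0 ⟩
      0# * x         ≈⟨ zeroˡ x ⟩
      0#             ∎

    [m*p]·x≈0 : ∀ m x → (m *ℕ p) · x ≈ 0#
    [m*p]·x≈0 m x = begin
      (m *ℕ p) · x   ≡⟨ ≡.cong (_· x) (ℕ.*-comm m p) ⟩
      (p *ℕ m) · x   ≈⟨ ×-assocˡ x p m ⟨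
      p · (m · x)    ≈⟨ p·x≈0 (m · x) ⟩
      0#             ∎

    m·x≈[m%p]·x : ∀ m x → m · x ≈ (m % p) · x
    m·x≈[m%p]·x m x = begin
      m · x                               ≡⟨ ≡.cong (_· x) (m≡m%n+[m/n]*n m p) ⟩
      (m % p +ℕ (m / p) *ℕ p) · x         ≈⟨ ×-homo-+ x (m % p) _ ⟩
      (m % p) · x + ((m / p) *ℕ p) · x    ≈⟨ +-congˡ ([m*p]·x≈0 (m / p) x) ⟩
      (m % p) · x + 0#                    ≈⟨ +-identityʳ _ ⟩
      (m % p) · x                         ∎

    [p∸1]·x≈-x : ∀ x → (p ∸ 1) · x ≈ - x
    [p∸1]·x≈-x x = begin
      (p ∸ 1) · x                ≈⟨ solve 2 (λ u v → v ⊜ (⊝ u ⊕ (u ⊕ v))) refl x ((p ∸ 1) · x) ⟩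
      - x + (x + (p ∸ 1) · x)    ≡⟨ ≡.cong (λ m → - x + m · x) (ℕ.m+[n∸m]≡n {1} {p} (ℕ.>-nonZero⁻¹ p)) ⟩
      - x + p · x                ≈⟨ +-congˡ (p·x≈0 x) ⟩
      - x + 0#                   ≈⟨ +-identityʳ _ ⟩
      - x                        ∎

    frobenius : IsAdditivePower p
    frobenius = freshmans-dream p inner≈0
      where
      inner≈0 : ∀ k → 0 < k → k < p → ∀ z → (p C k) · z ≈ 0#
      inner≈0 k 0<k k<p z with PrimeDivisibility.p∣pCk p-prime k 0<k k<p
      ... | divides r pCk≡r*p = trans (≡.subst (λ m → (p C k) · z ≈ m · z) pCk≡r*p refl) ([m*p]·x≈0 r z)

module FiniteRing {a ℓ} (R : CommutativeRing a ℓ) where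
  open CommutativeRing R
  open FieldTheory R
  open Characteristic R
  open AdditivePowers R using (IsAdditivePower; additivePower-^)
  open import Algebra.Properties.Ring ring using (-0#≈0#; +-cancelˡ)
  open import Algebra.Properties.CommutativeSemigroup +-commutativeSemigroup
    using () renaming (interchange to +-interchange)
  open import Algebra.Properties.Semiring.Mult semiring using (×-homo-+; ×-assocˡ; ×1-homo-*)
  open import Data.Nat.Coprimality using (coprime-Bézout; prime⇒coprime)
  open import Data.Nat.DivMod using (_%_; m%n<n)
  open import Data.Nat.GCD using (module Bézout)
  open import Data.Nat.Induction using (<-rec)
  open import Relation.Binary.Reasoning.Setoid setoid
  open IntegerCoefficientSolver R using (solve; _⊜_; _⊕_; ⊝_)

  module _ {N : ℕ} (card : HasCard N) where
    private
      enum : Fin N → Carrier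
      enum = proj₁ card

      index : Carrier → Fin N
      index x = proj₁ (proj₁ (proj₂ card) x)

      enum-index : ∀ x → enum (index x) ≈ x
      enum-index x = proj₂ (proj₁ (proj₂ card) x)

      index-injective : ∀ {x y} → index x ≡ index y → x ≈ y
      index-injective {x} {y} eq =
        trans (sym (enum-index x)) (trans (≡.subst (λ i → enum (index x) ≈ enum i) eq refl) (enum-index y))

      enum-injective : ∀ {i j} → enum i ≈ enum j → i ≡ j
      enum-injective = proj₂ (proj₂ card) _ _

      index-cong : ∀ {x y} → x ≈ y → index x ≡ index y
      index-cong {x} {y} x≈y = enum-injective (trans (enum-index x) (trans x≈y (sym (enum-index y))))

    _≈?_ : ∀ x y → Dec (x ≈ y)
    x ≈? y with index x Fin.≟ index y
    ... | yes eq = yes (index-injective eq)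
    ... | no  ne = no (ne ∘ index-cong)

    positive-characteristic : ∃ λ m → 0 < m × m · 1# ≈ 0#
    positive-characteristic with Fin.pigeonhole (ℕ.n<1+n N) (λ (i : Fin (suc N)) → index (toℕ i · 1#))
    ... | i , j , i<j , same-index = toℕ j ∸ toℕ i , ℕ.m<n⇒0<n∸m i<j , (begin
      d · 1#                        ≈⟨ solve 2 (λ u v → v ⊜ (⊝ u ⊕ (u ⊕ v))) refl (toℕ i · 1#) (d · 1#) ⟩
      - (toℕ i · 1#) + (toℕ i · 1# + d · 1#) ≈⟨ +-congˡ (×-homo-+ 1# (toℕ i) d) ⟨
      - (toℕ i · 1#) + (toℕ i +ℕ d) · 1#   ≡⟨ ≡.cong (λ m → - (toℕ i · 1#) + m · 1#) (ℕ.m+[n∸m]≡n (ℕ.<⇒≤ i<j)) ⟩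
      - (toℕ i · 1#) + toℕ j · 1#          ≈⟨ +-congˡ (index-injective same-index) ⟨
      - (toℕ i · 1#) + toℕ i · 1#          ≈⟨ -‿inverseˡ _ ⟩
      0#                                   ∎)
      where
        d : ℕ
        d = toℕ j ∸ toℕ i

    module _ {inv : Carrier → Carrier} (isField : IsField inv) where
      open IsField isField using (1≉0)
      open FieldLemmas R isField using (x*y≈0⇒y≈0)

      prime-characteristic : ∃ λ p → Prime p × p · 1# ≈ 0#
      prime-characteristic = let (m , 0<m , m·1≈0) = positive-characteristic in <-rec P step m 0<m m·1≈0
        where
        P : ℕ → Set ℓ
        P m = 0 < m → m · 1# ≈ 0# → ∃ λ p → Prime p × p · 1# ≈ 0#
        step : ∀ m → (∀ {k} → k < m → P k) → P m
        step 1 _ _ 1·1≈0 = contradiction (trans (sym (+-identityʳ 1#)) 1·1≈0) 1≉0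
        step m@(suc (suc _)) rec _ m·1≈0 with prime? m
        ... | yes m-prime = m , m-prime , m·1≈0
        ... | no ¬m-prime with ¬prime⇒composite ¬m-prime
        ...   | composite {d} d<m d∣m with (d · 1#) ≈? 0#
        ...     | yes d·1≈0 = rec d<m (ℕ.<-trans (s≤s z≤n) (ℕ.nonTrivial⇒n>1 d)) d·1≈0
        ...     | no  d·1≉0 = rec (quotient-< d∣m) e>0 (x*y≈0⇒y≈0 (trans (*-comm _ _) e·1*d·1≈0) d·1≉0)
          where
          e : ℕ
          e = quotient d∣m
          e·1*d·1≈0 : (e · 1#) * (d · 1#) ≈ 0#
          e·1*d·1≈0 = trans (sym (×1-homo-* e d)) (trans (≡.subst (λ k → k · 1# ≈ m · 1#) (m∣n⇒n≡quotient*m d∣m) refl) m·1≈0)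
          e>0 : 0 < e
          e>0 with e | m∣n⇒n≡quotient*m d∣m
          ... | suc _ | _ = s≤s z≤n

    module _ {p : ℕ} (p-prime : Prime p) (p·1≈0 : p · 1# ≈ 0#) where
      private instance
        p≢0 : NonZero p
        p≢0 = prime⇒nonZero p-prime

      -- N is a power of p: a subspace V with p^k elements that misses some x extends to one with p^(k+1)
      -- elements, the union of the p cosets a·x + V (a < p), which are pairwise disjoint because p is prime.
      record Subspace (k : ℕ) : Set (a ⊔ ℓ) where
        field
          vec           : Fin (p ^ℕ k) → Carrier
          vec-injective : ∀ i j → vec i ≈ vec j → i ≡ j
          0#∈           : ∃ λ i → vec i ≈ 0#
          +-closed      : ∀ i j → ∃ λ l → vec l ≈ vec i + vec j

      _∈_ : ∀ {k} → Carrier → Subspace k → Set ℓ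
      x ∈ V = ∃ λ i → Subspace.vec V i ≈ x

      module _ {k} (V : Subspace k) where
        open Subspace V

        ∈-resp-≈ : ∀ {x y} → x ≈ y → x ∈ V → y ∈ V
        ∈-resp-≈ x≈y (i , vᵢ≈x) = i , trans vᵢ≈x x≈y

        +-closedˡ : ∀ {x y} → x ∈ V → y ∈ V → (x + y) ∈ V
        +-closedˡ (i , vᵢ≈x) (j , vⱼ≈y) = let (l , vₗ≈) = +-closed i j in l , trans vₗ≈ (+-cong vᵢ≈x vⱼ≈y)

        ·-closed : ∀ m {x} → x ∈ V → (m · x) ∈ V
        ·-closed zero    _   = 0#∈
        ·-closed (suc m) x∈V = +-closedˡ x∈V (·-closed m x∈V)

        -‿closed : ∀ {x} → x ∈ V → (- x) ∈ V
        -‿closed x∈V = ∈-resp-≈ ([p∸1]·x≈-x p-prime p·1≈0 _) (·-closed (p ∸ 1) x∈V)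

        ·-cancel : ∀ {d x} → 0 < d → d < p → (d · x) ∈ V → x ∈ V
        ·-cancel {d} {x} 0<d d<p d·x∈V with coprime-Bézout (prime⇒coprime p-prime {{ℕ.>-nonZero 0<d}} d<p)
        ... | Bézout.-+ u v 1+u*p≡v*d = ∈-resp-≈ (begin
            v · (d · x)            ≈⟨ ×-assocˡ x v d ⟩
            (v *ℕ d) · x           ≡⟨ ≡.cong (_· x) (≡.sym 1+u*p≡v*d) ⟩
            (1 +ℕ u *ℕ p) · x      ≈⟨ ×-homo-+ x 1 (u *ℕ p) ⟩
            (x + 0#) + (u *ℕ p) · x ≈⟨ +-cong (+-identityʳ x) ([m*p]·x≈0 p-prime p·1≈0 u x) ⟩
            x + 0#                 ≈⟨ +-identityʳ x ⟩
            x                      ∎) (·-closed v d·x∈V)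
        ... | Bézout.+- u v 1+v*d≡u*p = ∈-resp-≈ (begin
            - (v · (d · x))        ≈⟨ -‿cong (×-assocˡ x v d) ⟩
            - ((v *ℕ d) · x)       ≈⟨ solve 2 (λ u w → (⊝ w) ⊜ (u ⊕ ⊝ (u ⊕ w))) refl x _ ⟩
            x - (1 +ℕ v *ℕ d) · x  ≡⟨ ≡.cong (λ m → x - m · x) 1+v*d≡u*p ⟩
            x - (u *ℕ p) · x       ≈⟨ +-congˡ (trans (-‿cong ([m*p]·x≈0 p-prime p·1≈0 u x)) -0#≈0#) ⟩
            x + 0#                 ≈⟨ +-identityʳ x ⟩
            x                      ∎) (-‿closed (·-closed v d·x∈V))

      module Extension {k} (V : Subspace k) {x} (x∉V : ¬ x ∈ V) where
        open Subspace V
        M : ℕ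
        M = p ^ℕ k

        point : Fin p → Fin M → Carrier
        point a b = toℕ a · x + vec b

        vec′ : Fin (p ^ℕ suc k) → Carrier
        vec′ i = point (proj₁ (Fin.remQuot {p} M i)) (proj₂ (Fin.remQuot {p} M i))

        vec′-combine : ∀ a b → vec′ (Fin.combine a b) ≡ point a b
        vec′-combine a b = ≡.cong (λ ab → point (proj₁ ab) (proj₂ ab)) (Fin.remQuot-combine {p} {M} a b)

        coefficients-ordered⇒distinct : ∀ a a′ b b′ → toℕ a < toℕ a′ → ¬ point a b ≈ point a′ b′
        coefficients-ordered⇒distinct a a′ b b′ a<a′ eq =
          x∉V (·-cancel V (ℕ.m<n⇒0<n∸m a<a′) d<p (∈-resp-≈ V vb-vb′≈d·x vb-vb′∈V))
          where
          d : ℕ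
          d = toℕ a′ ∸ toℕ a
          d<p : d < p
          d<p = ℕ.≤-<-trans (ℕ.m∸n≤m (toℕ a′) (toℕ a)) (Fin.toℕ<n a′)
          a′·x≈a·x+d·x : toℕ a′ · x ≈ toℕ a · x + d · x
          a′·x≈a·x+d·x = trans (≡.subst (λ m → toℕ a′ · x ≈ m · x) (≡.sym (ℕ.m+[n∸m]≡n (ℕ.<⇒≤ a<a′))) refl)
                                (×-homo-+ x (toℕ a) d)
          vb-vb′∈V : (vec b - vec b′) ∈ V
          vb-vb′∈V = +-closedˡ V (b , refl) (-‿closed V (b′ , refl))
          vb-vb′≈d·x : vec b - vec b′ ≈ d · x
          vb-vb′≈d·x = begin
            vec b - vec b′
              ≈⟨ solve 3 (λ u v w → (v ⊕ ⊝ w) ⊜ ((⊝ u ⊕ (u ⊕ v)) ⊕ ⊝ w)) refl (toℕ a · x) (vec b) (vec b′) ⟩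
            (- (toℕ a · x) + point a b) - vec b′
              ≈⟨ +-congʳ (+-congˡ (trans eq (+-congʳ a′·x≈a·x+d·x))) ⟩
            (- (toℕ a · x) + ((toℕ a · x + d · x) + vec b′)) - vec b′
              ≈⟨ solve 3 (λ u v w → ((⊝ u ⊕ ((u ⊕ v) ⊕ w)) ⊕ ⊝ w) ⊜ v) refl (toℕ a · x) (d · x) (vec b′) ⟩
            d · x ∎

        point-injective : ∀ a a′ b b′ → point a b ≈ point a′ b′ → a ≡ a′ × b ≡ b′
        point-injective a a′ b b′ eq with ℕ.<-cmp (toℕ a) (toℕ a′)
        ... | tri< a<a′ _ _ = contradiction eq (coefficients-ordered⇒distinct a a′ b b′ a<a′)
        ... | tri> _ _ a>a′ = contradiction (sym eq) (coefficients-ordered⇒distinct a′ a b′ b a>a′)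
        ... | tri≈ _ a≡a′ _ with Fin.toℕ-injective a≡a′
        ...   | ≡.refl = ≡.refl , vec-injective b b′ (+-cancelˡ (toℕ a · x) (vec b) (vec b′) eq)

        vec′-injective : ∀ i j → vec′ i ≈ vec′ j → i ≡ j
        vec′-injective i j eq with point-injective _ _ _ _ eq
        ... | a≡a′ , b≡b′ = ≡.trans (≡.sym (Fin.combine-remQuot {p} M i))
            (≡.trans (≡.cong₂ Fin.combine a≡a′ b≡b′) (Fin.combine-remQuot {p} M j))

        zeroᶠ : Fin p
        zeroᶠ = Fin.fromℕ< (ℕ.>-nonZero⁻¹ p)

        0#∈′ : ∃ λ i → vec′ i ≈ 0#
        0#∈′ = let (i , vᵢ≈0) = 0#∈ in Fin.combine {p} {M} zeroᶠ i , (begin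
          vec′ (Fin.combine {p} {M} zeroᶠ i) ≡⟨ vec′-combine zeroᶠ i ⟩
          toℕ zeroᶠ · x + vec i      ≡⟨ ≡.cong (λ m → m · x + vec i) (Fin.toℕ-fromℕ< (ℕ.>-nonZero⁻¹ p)) ⟩
          0# + vec i                 ≈⟨ +-identityˡ _ ⟩
          vec i                      ≈⟨ vᵢ≈0 ⟩
          0#                         ∎)

        +-closed′ : ∀ i j → ∃ λ l → vec′ l ≈ vec′ i + vec′ j
        +-closed′ i j = Fin.combine {p} {M} c l , (begin
          vec′ (Fin.combine {p} {M} c l)      ≡⟨ vec′-combine c l ⟩
          toℕ c · x + vec l                   ≡⟨ ≡.cong (λ m → m · x + vec l) (Fin.toℕ-fromℕ< (m%n<n (A +ℕ A′) p)) ⟩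
          ((A +ℕ A′) % p) · x + vec l         ≈⟨ +-cong (sym (m·x≈[m%p]·x p-prime p·1≈0 (A +ℕ A′) x)) vₗ≈ ⟩
          (A +ℕ A′) · x + (vec b + vec b′)    ≈⟨ +-congʳ (×-homo-+ x A A′) ⟩
          (A · x + A′ · x) + (vec b + vec b′) ≈⟨ +-interchange _ _ _ _ ⟩
          vec′ i + vec′ j                     ∎)
          where
          A A′ : ℕ
          A  = toℕ (proj₁ (Fin.remQuot {p} M i))
          A′ = toℕ (proj₁ (Fin.remQuot {p} M j))
          b b′ : Fin M
          b  = proj₂ (Fin.remQuot {p} M i)
          b′ = proj₂ (Fin.remQuot {p} M j)
          l : Fin M
          l  = proj₁ (+-closed b b′)
          vₗ≈ : vec l ≈ vec b + vec b′
          vₗ≈ = proj₂ (+-closed b b′)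
          c : Fin p
          c = Fin.fromℕ< (m%n<n (A +ℕ A′) p)

        extended : Subspace (suc k)
        extended = record
          { vec = vec′ ; vec-injective = vec′-injective ; 0#∈ = 0#∈′ ; +-closed = +-closed′ }

      extend : ∀ {k} (V : Subspace k) {x} → ¬ x ∈ V → Subspace (suc k)
      extend V x∉V = Extension.extended V x∉V

      trivial-subspace : Subspace 0
      trivial-subspace = record
        { vec = λ _ → 0#
        ; vec-injective = λ { Fin.zero Fin.zero _ → ≡.refl }
        ; 0#∈ = Fin.zero , refl
        ; +-closed = λ _ _ → Fin.zero , sym (+-identityʳ 0#)
        }

      subspace-size≤N : ∀ {k} → Subspace k → p ^ℕ k ≤ N
      subspace-size≤N V = Fin.injective⇒≤ (λ {i} {j} eq → vec-injective i j (index-injective eq))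
        where open Subspace V

      spanning⇒N≤size : ∀ {k} (V : Subspace k) → (∀ j → enum j ∈ V) → N ≤ p ^ℕ k
      spanning⇒N≤size V spans = Fin.injective⇒≤ {f = proj₁ ∘ spans} (λ {j} {j′} eq →
        proj₂ (proj₂ card) j j′ (trans (sym (proj₂ (spans j)))
          (trans (≡.subst (λ i → Subspace.vec V (proj₁ (spans j)) ≈ Subspace.vec V i) eq refl) (proj₂ (spans j′)))))

      saturate : ∀ fuel {k} → Subspace k → N ≤ p ^ℕ k +ℕ fuel → ∃ λ k → N ≡ p ^ℕ k
      saturate zero {k} V N≤ = k , ℕ.≤-antisym (≡.subst (N ≤_) (ℕ.+-identityʳ _) N≤) (subspace-size≤N V)
      saturate (suc fuel) {k} V N≤ with Fin.all? (λ j → Fin.any? (λ i → Subspace.vec V i ≈? enum j))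
      ... | yes spans = k , ℕ.≤-antisym (spanning⇒N≤size V spans) (subspace-size≤N V)
      ... | no ¬spans = saturate fuel (extend V (proj₂ missing))
          (ℕ.≤-trans N≤ (ℕ.≤-trans (ℕ.≤-reflexive (ℕ.+-suc (p ^ℕ k) fuel)) (ℕ.+-monoˡ-≤ fuel p^k<p^[1+k])))
        where
        missing : ∃ λ j → ¬ enum j ∈ V
        missing = Fin.¬∀⟶∃¬ N _ (λ j → Fin.any? (λ i → Subspace.vec V i ≈? enum j)) ¬spans
        p^k<p^[1+k] : p ^ℕ k < p ^ℕ suc k
        p^k<p^[1+k] = ℕ.<-≤-trans (ℕ.m<m*n (p ^ℕ k) p {{ℕ.m^n≢0 p k}} (ℕ.nonTrivial⇒n>1 p {{prime⇒nonTrivial p-prime}}))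
                                  (ℕ.≤-reflexive (ℕ.*-comm (p ^ℕ k) p))

      card≡p^k : ∃ λ k → N ≡ p ^ℕ k
      card≡p^k = saturate N trivial-subspace (ℕ.m≤n+m N 1)

  frobenius-additive : ∀ {inv} → IsField inv → ∀ {q n} → .{{NonZero n}} → HasCard (q ^ℕ n) → IsAdditivePower q
  frobenius-additive isField {q} {n} card =
    let (p , p-prime , p·1≈0) = prime-characteristic card isField
        (k , qⁿ≡pᵏ)           = card≡p^k card p-prime p·1≈0
        (m , q≡pᵐ)            = PrimeDivisibility.d∣p^k⇒d≡p^m p-prime k (≡.subst (q ∣_) qⁿ≡pᵏ (PrimeDivisibility.m∣m^n q n))
    in ≡.subst IsAdditivePower (≡.sym q≡pᵐ) (additivePower-^ (frobenius p-prime p·1≈0) m)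

module Conjugates {a ℓ} (R : CommutativeRing a ℓ) where
  open CommutativeRing R
  open FieldTheory R
  open Sums R
  open import Algebra.Properties.Semiring.Exp semiring using (^-assocʳ)
  open import Algebra.Properties.CommutativeSemiring.Exp commutativeSemiring using (^-distrib-*)
  open import Algebra.Properties.CommutativeSemigroup *-commutativeSemigroup using (x∙yz≈z∙xy)
  open import Algebra.Properties.Ring ring using (-0#≈0#)
  open import Relation.Binary.Reasoning.Setoid setoid
  open IntegerCoefficientSolver R using (solve; _⊜_; _⊕_; _⊗_; ⊝_)

  eval : ℕ → (ℕ → Carrier) → Carrier → Carrier
  eval m P x = sumFrom 0 m (λ i → P i * x ^ i)

  ^-comm-^ : ∀ x m e → (x ^ m) ^ e ≈ (x ^ e) ^ m
  ^-comm-^ x m e = trans (^-assocʳ x m e) (trans (≡.subst (λ k → x ^ (m *ℕ e) ≈ x ^ k) (ℕ.*-comm m e) refl)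
                                                  (sym (^-assocʳ x e m)))

  kron-diag : ∀ l → kron l l ≈ 1#
  kron-diag l rewrite ≡ᵇ-refl l = refl

  kron-off : ∀ {i l} → i ≢ l → kron i l ≈ 0#
  kron-off i≢l rewrite ≢⇒≡ᵇ≡false i≢l = refl

  pPoly≈linPoly : ∀ q n t θ μ (A : ℕ → Carrier) →
    (∀ j → j < n → sumRange t n (λ i → θ ^ i * μ i ^ (q ^ℕ j)) ≈ A j) →
    ∀ x → pPoly q n t θ μ x ≈ linPoly q n A x
  pPoly≈linPoly q n t θ μ A coefficient≈A x = begin
    sumFrom t (n ∸ t) (λ i → θ ^ i * sumFrom 0 n (λ j → (μ i * x) ^ (q ^ℕ j)))
      ≈⟨ sumFrom-cong t (n ∸ t) (λ i → trans (*-distribˡ-sumFrom _ 0 n _)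
         (sumFrom-cong 0 n (λ j → trans (*-congˡ (^-distrib-* (μ i) x (q ^ℕ j))) (sym (*-assoc _ _ _))))) ⟩
    sumFrom t (n ∸ t) (λ i → sumFrom 0 n (λ j → (θ ^ i * μ i ^ (q ^ℕ j)) * x ^ (q ^ℕ j)))
      ≈⟨ sumFrom-comm t (n ∸ t) 0 n _ ⟩
    sumFrom 0 n (λ j → sumFrom t (n ∸ t) (λ i → (θ ^ i * μ i ^ (q ^ℕ j)) * x ^ (q ^ℕ j)))
      ≈⟨ sumFrom-cong-on 0 n (λ j _ j<n → trans (sym (*-distribʳ-sumFrom _ t (n ∸ t) _)) (*-congʳ (coefficient≈A j j<n))) ⟩
    sumFrom 0 n (λ j → A j * x ^ (q ^ℕ j)) ∎

  -- mulLinear r P and linearProduct m r are the coefficient sequences of (x - r)·P and of ∏_{i<m} (x - r i).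
  mulLinear : Carrier → (ℕ → Carrier) → ℕ → Carrier
  mulLinear r P zero    = - (r * P 0)
  mulLinear r P (suc i) = P i - r * P (suc i)

  linearProduct : ∀ m → (Fin m → Carrier) → ℕ → Carrier
  linearProduct zero    r zero    = 1#
  linearProduct zero    r (suc _) = 0#
  linearProduct (suc m) r         = mulLinear (r Fin.zero) (linearProduct m (r ∘ Fin.suc))

  linearProduct-high : ∀ m r i → m < i → linearProduct m r i ≈ 0#
  linearProduct-high zero    r (suc i) _         = refl
  linearProduct-high (suc m) r (suc i) (s≤s m<i) = begin
    P i - r Fin.zero * P (suc i)
      ≈⟨ +-cong (linearProduct-high m _ i m<i)
         (-‿cong (trans (*-congˡ (linearProduct-high m _ (suc i) (ℕ.m<n⇒m<1+n m<i))) (zeroʳ _))) ⟩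
    0# - 0#
      ≈⟨ -‿inverseʳ 0# ⟩
    0# ∎
    where
      P : ℕ → Carrier
      P = linearProduct m (r ∘ Fin.suc)

  linearProduct-top : ∀ m r → linearProduct m r m ≈ 1#
  linearProduct-top zero    r = refl
  linearProduct-top (suc m) r = begin
    P m - r Fin.zero * P (suc m) ≈⟨ +-cong (linearProduct-top m _)
                                     (-‿cong (trans (*-congˡ (linearProduct-high m _ (suc m) ℕ.≤-refl)) (zeroʳ _))) ⟩
    1# - 0#                       ≈⟨ trans (+-congˡ -0#≈0#) (+-identityʳ 1#) ⟩
    1#                            ∎
    where
      P : ℕ → Carrier
      P = linearProduct m (r ∘ Fin.suc)

  eval-mulLinear′ : ∀ m r P x → eval (suc m) (mulLinear r P) x ≈ x * eval m P x - r * eval (suc m) P x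
  eval-mulLinear′ zero r P x = begin
    - (r * P 0) * 1# + 0#            ≈⟨ trans (+-identityʳ _) (*-identityʳ _) ⟩
    - (r * P 0)                      ≈⟨ +-identityˡ _ ⟨
    0# - r * P 0                     ≈⟨ +-cong (zeroʳ x) (-‿cong (*-congˡ (trans (+-identityʳ _) (*-identityʳ _)))) ⟨
    x * 0# - r * (P 0 * 1# + 0#)     ∎
  eval-mulLinear′ (suc m) r P x = begin
    eval (suc (suc m)) (mulLinear r P) x
      ≈⟨ sumFrom-snoc 0 (suc m) _ ⟩
    eval (suc m) (mulLinear r P) x + (P m - r * P (suc m)) * x ^ suc m
      ≈⟨ +-congʳ (eval-mulLinear′ m r P x) ⟩
    (x * eval m P x - r * eval (suc m) P x) + (P m - r * P (suc m)) * (x * x ^ m)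
      ≈⟨ solve 7 (λ x r e e′ p p′ xᵐ →
         (((x ⊗ e) ⊕ ⊝ (r ⊗ e′)) ⊕ ((p ⊕ ⊝ (r ⊗ p′)) ⊗ (x ⊗ xᵐ))) ⊜
         ((x ⊗ (e ⊕ (p ⊗ xᵐ))) ⊕ ⊝ (r ⊗ (e′ ⊕ (p′ ⊗ (x ⊗ xᵐ))))))
         refl x r (eval m P x) (eval (suc m) P x) (P m) (P (suc m)) (x ^ m) ⟩
    x * (eval m P x + P m * x ^ m) - r * (eval (suc m) P x + P (suc m) * x ^ suc m)
      ≈⟨ +-cong (*-congˡ (sumFrom-snoc 0 m _)) (-‿cong (*-congˡ (sumFrom-snoc 0 (suc m) _))) ⟨
    x * eval (suc m) P x - r * eval (suc (suc m)) P x ∎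

  eval-mulLinear : ∀ m r P x → P m ≈ 0# → eval (suc m) (mulLinear r P) x ≈ (x - r) * eval (suc m) P x
  eval-mulLinear m r P x Pₘ≈0 = begin
    eval (suc m) (mulLinear r P) x
      ≈⟨ eval-mulLinear′ m r P x ⟩
    x * eval m P x - r * eval (suc m) P x
      ≈⟨ +-congʳ (*-congˡ eval-suc≈eval) ⟨
    x * eval (suc m) P x - r * eval (suc m) P x
      ≈⟨ solve 3 (λ x r e → ((x ⊗ e) ⊕ ⊝ (r ⊗ e)) ⊜ ((x ⊕ ⊝ r) ⊗ e)) refl x r _ ⟩
    (x - r) * eval (suc m) P x ∎
    where
    eval-suc≈eval : eval (suc m) P x ≈ eval m P x
    eval-suc≈eval = trans (sumFrom-snoc 0 m _) (trans (+-congˡ (trans (*-congʳ Pₘ≈0) (zeroˡ _))) (+-identityʳ _))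

  linearProduct-root : ∀ m r M x i → m ≤ M → x ≈ r i → eval (suc M) (linearProduct m r) x ≈ 0#
  linearProduct-root (suc m) r M x i m<M x≈rᵢ =
    trans (eval-mulLinear M (r Fin.zero) P x (linearProduct-high m _ M m<M)) (root i x≈rᵢ)
    where
    P : ℕ → Carrier
    P = linearProduct m (r ∘ Fin.suc)
    root : ∀ i → x ≈ r i → (x - r Fin.zero) * eval (suc M) P x ≈ 0#
    root Fin.zero    x≈r₀ = trans (*-congʳ (trans (+-congʳ x≈r₀) (-‿inverseʳ _))) (zeroˡ _)
    root (Fin.suc i) x≈rᵢ = trans (*-congˡ (linearProduct-root m (r ∘ Fin.suc) M x i (ℕ.<⇒≤ m<M) x≈rᵢ)) (zeroʳ _)

  conjugate : ℕ → Carrier → ℕ → Carrier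
  conjugate q θ j = θ ^ (q ^ℕ j)

  module _ {q n : ℕ} {θ : Carrier} {μ : ℕ → Carrier} where

    coefficient-via-conjugates : IsDualBasis q n (θ ^_) μ → ∀ P l → l < n →
                                 P l ≈ sumFrom 0 n (λ j → μ l ^ (q ^ℕ j) * eval n P (conjugate q θ j))
    coefficient-via-conjugates dual P l l<n = begin
      P l
        ≈⟨ *-identityʳ _ ⟨
      P l * 1#
        ≈⟨ *-congˡ (kron-diag l) ⟨
      P l * kron l l
        ≈⟨ sumFrom-single 0 n l _ z≤n l<n (λ i _ _ i≢l → trans (*-congˡ (kron-off i≢l)) (zeroʳ _)) ⟨
      sumFrom 0 n (λ i → P i * kron i l)
        ≈⟨ sumFrom-cong-on 0 n (λ i _ i<n → *-congˡ (dual i l i<n l<n)) ⟨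
      sumFrom 0 n (λ i → P i * Tr q n (θ ^ i * μ l))
        ≈⟨ sumFrom-cong 0 n (λ i → *-distribˡ-sumFrom (P i) 0 n _) ⟩
      sumFrom 0 n (λ i → sumFrom 0 n (λ j → P i * (θ ^ i * μ l) ^ (q ^ℕ j)))
        ≈⟨ sumFrom-comm 0 n 0 n _ ⟩
      sumFrom 0 n (λ j → sumFrom 0 n (λ i → P i * (θ ^ i * μ l) ^ (q ^ℕ j)))
        ≈⟨ sumFrom-cong 0 n (λ j → trans (sumFrom-cong 0 n (λ i → term i j)) (sym (*-distribˡ-sumFrom _ 0 n _))) ⟩
      sumFrom 0 n (λ j → μ l ^ (q ^ℕ j) * eval n P (conjugate q θ j)) ∎
      where
      term : ∀ i j → P i * (θ ^ i * μ l) ^ (q ^ℕ j) ≈ μ l ^ (q ^ℕ j) * (P i * conjugate q θ j ^ i)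
      term i j = begin
        P i * (θ ^ i * μ l) ^ (q ^ℕ j)               ≈⟨ *-congˡ (^-distrib-* (θ ^ i) (μ l) (q ^ℕ j)) ⟩
        P i * ((θ ^ i) ^ (q ^ℕ j) * μ l ^ (q ^ℕ j))  ≈⟨ *-congˡ (*-congʳ (^-comm-^ θ i (q ^ℕ j))) ⟩
        P i * (conjugate q θ j ^ i * μ l ^ (q ^ℕ j))          ≈⟨ x∙yz≈z∙xy _ _ _ ⟩
        μ l ^ (q ^ℕ j) * (P i * conjugate q θ j ^ i)          ∎

    vanishing-on-conjugates⇒zero : IsDualBasis q n (θ ^_) μ → ∀ P → (∀ j → j < n → eval n P (conjugate q θ j) ≈ 0#) →
                                   ∀ l → l < n → P l ≈ 0#
    vanishing-on-conjugates⇒zero dual P vanishes l l<n = trans (coefficient-via-conjugates dual P l l<n)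
      (sumFrom-zero 0 n (λ j _ j<n → trans (*-congˡ (vanishes j j<n)) (zeroʳ _)))

  -- If two conjugates coincided, the monic polynomial of degree n - 1 whose roots are the other n - 1
  -- conjugates would vanish at all n of them, so its leading coefficient would be 0.
  conjugates-injective : ∀ {q n θ μ} → IsDualBasis q n (θ ^_) μ → ¬ 1# ≈ 0# →
                         ∀ {j j′} → j < n → j′ < n → conjugate q θ j ≈ conjugate q θ j′ → j ≡ j′
  conjugates-injective {q} {suc n₁} {θ} dual 1≉0 {j} {j′} j<n j′<n cⱼ≈cⱼ′ with j ℕ.≟ j′
  ... | yes j≡j′ = j≡j′
  ... | no  j≢j′ =
    contradiction (trans (sym (linearProduct-top n₁ r)) (vanishing-on-conjugates⇒zero dual h roots n₁ ℕ.≤-refl)) 1≉0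
    where
    c : ℕ → Carrier
    c = conjugate q θ
    b : Fin (suc n₁)
    b = Fin.fromℕ< j′<n
    r : Fin n₁ → Carrier
    r i = c (toℕ (Fin.punchIn b i))
    h : ℕ → Carrier
    h = linearProduct n₁ r
    r-at : ∀ {l} (l<n : l < suc n₁) (b≢l : b ≢ Fin.fromℕ< l<n) → c l ≈ r (Fin.punchOut b≢l)
    r-at {l} l<n b≢l = ≡.subst (λ i → c l ≈ c i)
      (≡.trans (≡.sym (Fin.toℕ-fromℕ< l<n)) (≡.cong toℕ (≡.sym (Fin.punchIn-punchOut b≢l)))) refl
    roots : ∀ l → l < suc n₁ → eval (suc n₁) h (c l) ≈ 0#
    roots l l<n with Fin.fromℕ< l<n Fin.≟ b
    ... | no  l≢b = linearProduct-root n₁ r n₁ (c l) _ ℕ.≤-refl (r-at l<n (l≢b ∘ ≡.sym))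
    ... | yes l≡b = linearProduct-root n₁ r n₁ (c l) _ ℕ.≤-refl (trans cₗ≈cⱼ (r-at j<n (a≢b ∘ ≡.sym)))
      where
      l≡j′ : l ≡ j′
      l≡j′ = ≡.trans (≡.sym (Fin.toℕ-fromℕ< l<n)) (≡.trans (≡.cong toℕ l≡b) (Fin.toℕ-fromℕ< j′<n))
      cₗ≈cⱼ : c l ≈ c j
      cₗ≈cⱼ = ≡.subst (λ i → c i ≈ c j) (≡.sym l≡j′) (sym cⱼ≈cⱼ′)
      a≢b : Fin.fromℕ< j<n ≢ b
      a≢b a≡b = j≢j′ (≡.trans (≡.sym (Fin.toℕ-fromℕ< j<n)) (≡.trans (≡.cong toℕ a≡b) (Fin.toℕ-fromℕ< j′<n)))

module Trinomials {a ℓ} (R : CommutativeRing a ℓ) where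
  open CommutativeRing R
  open FieldTheory R
  open Sums R
  open Conjugates R using (eval; ^-comm-^)
  open AdditivePowers R using (IsAdditivePower; additivePower--)
  open import Algebra.Properties.CommutativeSemigroup *-commutativeSemigroup using (x∙yz≈y∙xz)
  open import Algebra.Properties.CommutativeSemiring.Exp commutativeSemiring using (^-distrib-*)
  open import Algebra.Properties.Ring ring using (-0#≈0#)
  open import Algebra.Properties.Semiring.Mult semiring using (×-congʳ; ×-assoc-*; ×-comm-*)
  open import Relation.Binary.Reasoning.Setoid setoid
  open IntegerCoefficientSolver R using (solve; _⊜_; _⊕_; _⊗_; ⊝_)

  geometric : ℕ → Carrier → Carrier → Carrier
  geometric m x y = sumFrom 0 m (λ l → x ^ l * y ^ (m ∸ suc l))

  geometric-suc : ∀ m x y → geometric (suc m) x y ≈ y * geometric m x y + x ^ m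
  geometric-suc m x y = begin
    sumFrom 0 (suc m) (λ l → x ^ l * y ^ (m ∸ l))
      ≈⟨ sumFrom-snoc 0 m _ ⟩
    sumFrom 0 m (λ l → x ^ l * y ^ (m ∸ l)) + x ^ m * y ^ (m ∸ m)
      ≈⟨ +-cong (sumFrom-cong-on 0 m (λ l _ l<m → *-congˡ (≡.subst (λ e → y ^ (m ∸ l) ≈ y ^ e) (ℕ.+-∸-assoc 1 l<m) refl)))
         (≡.subst (λ e → x ^ m * y ^ e ≈ x ^ m) (≡.sym (ℕ.n∸n≡0 m)) (*-identityʳ _)) ⟩
    sumFrom 0 m (λ l → x ^ l * (y * y ^ (m ∸ suc l))) + x ^ m
      ≈⟨ +-congʳ (trans (sumFrom-cong 0 m (λ l → x∙yz≈y∙xz (x ^ l) y _)) (sym (*-distribˡ-sumFrom y 0 m _))) ⟩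
    y * geometric m x y + x ^ m ∎

  geometric-telescope : ∀ m x y → (x - y) * geometric m x y ≈ x ^ m - y ^ m
  geometric-telescope zero    x y = trans (zeroʳ _) (sym (-‿inverseʳ 1#))
  geometric-telescope (suc m) x y = begin
    (x - y) * geometric (suc m) x y
      ≈⟨ *-congˡ (geometric-suc m x y) ⟩
    (x - y) * (y * geometric m x y + x ^ m)
      ≈⟨ solve 4 (λ x y g xᵐ → ((x ⊕ ⊝ y) ⊗ (y ⊗ g ⊕ xᵐ)) ⊜ (y ⊗ ((x ⊕ ⊝ y) ⊗ g) ⊕ (x ⊕ ⊝ y) ⊗ xᵐ)) refl x y _ _ ⟩
    y * ((x - y) * geometric m x y) + (x - y) * x ^ m
      ≈⟨ +-congʳ (*-congˡ (geometric-telescope m x y)) ⟩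
    y * (x ^ m - y ^ m) + (x - y) * x ^ m
      ≈⟨ solve 4 (λ x y xᵐ yᵐ → (y ⊗ (xᵐ ⊕ ⊝ yᵐ) ⊕ (x ⊕ ⊝ y) ⊗ xᵐ) ⊜ (x ⊗ xᵐ ⊕ ⊝ (y ⊗ yᵐ))) refl x y _ _ ⟩
    x ^ suc m - y ^ suc m ∎

  geometric-diagonal : ∀ m y → geometric m y y ≈ m · y ^ (m ∸ 1)
  geometric-diagonal zero          y = refl
  geometric-diagonal (suc zero)    y = trans (geometric-suc 0 y y) (trans (+-congʳ (zeroʳ y)) (+-comm _ _))
  geometric-diagonal (suc (suc m)) y = begin
    geometric (suc (suc m)) y y          ≈⟨ geometric-suc (suc m) y y ⟩
    y * geometric (suc m) y y + y ^ suc m ≈⟨ +-congʳ (*-congˡ (geometric-diagonal (suc m) y)) ⟩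
    y * (suc m · y ^ m) + y ^ suc m      ≈⟨ +-congʳ (×-comm-* (suc m) y (y ^ m)) ⟩
    suc m · y ^ suc m + y ^ suc m        ≈⟨ +-comm _ _ ⟩
    suc (suc m) · y ^ suc m              ∎

  -- For F = trinomial n k c d: trinomial′ n k c is F′, and dividedDifference n k c y l is the coefficient
  -- of x^l in (F(x) - F(y))/(x - y).
  trinomial : ℕ → ℕ → Carrier → Carrier → Carrier → Carrier
  trinomial n k c d z = z ^ n - c * z ^ k - d

  trinomial′ : ℕ → ℕ → Carrier → Carrier → Carrier
  trinomial′ n k c y = n · 1# * y ^ (n ∸ 1) - (k · c) * y ^ (k ∸ 1)

  dividedDifference : ℕ → ℕ → Carrier → Carrier → ℕ → Carrier
  dividedDifference n k c y l = y ^ (n ∸ suc l) - (if l <ᵇ k then c * y ^ (k ∸ suc l) else 0#)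

  module _ (n k : ℕ) (c : Carrier) where

    eval-dividedDifference : k ≤ n → ∀ x y → eval n (dividedDifference n k c y) x ≈ geometric n x y - c * geometric k x y
    eval-dividedDifference k≤n x y = begin
      sumFrom 0 n (λ l → (y ^ (n ∸ suc l) - low l) * x ^ l)
        ≈⟨ sumFrom-cong 0 n (λ l → solve 3 (λ u v w → ((u ⊕ ⊝ v) ⊗ w) ⊜ (w ⊗ u ⊕ ⊝ (v ⊗ w))) refl _ (low l) (x ^ l)) ⟩
      sumFrom 0 n (λ l → x ^ l * y ^ (n ∸ suc l) + - (low l * x ^ l))
        ≈⟨ sumFrom-distrib-+ 0 n _ _ ⟩
      geometric n x y + sumFrom 0 n (λ l → - (low l * x ^ l))
        ≈⟨ +-congˡ (-‿distrib-sumFrom 0 n _) ⟨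
      geometric n x y - sumFrom 0 n (λ l → low l * x ^ l)
        ≈⟨ +-congˡ (-‿cong (sumRange-split 0 k n _ z≤n k≤n)) ⟩
      geometric n x y - (sumFrom 0 k (λ l → low l * x ^ l) + sumRange k n (λ l → low l * x ^ l))
        ≈⟨ +-congˡ (-‿cong (+-cong (sumFrom-cong-on 0 k below) (sumFrom-zero k (n ∸ k) above))) ⟩
      geometric n x y - (sumFrom 0 k (λ l → c * (x ^ l * y ^ (k ∸ suc l))) + 0#)
        ≈⟨ +-congˡ (-‿cong (trans (+-identityʳ _) (sym (*-distribˡ-sumFrom c 0 k _)))) ⟩
      geometric n x y - c * geometric k x y ∎
      where
      low : ℕ → Carrier
      low l = if l <ᵇ k then c * y ^ (k ∸ suc l) else 0#
      below : ∀ l → 0 ≤ l → l < k → low l * x ^ l ≈ c * (x ^ l * y ^ (k ∸ suc l))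
      below l _ l<k rewrite <⇒<ᵇ≡true l<k = solve 3 (λ c u v → ((c ⊗ v) ⊗ u) ⊜ (c ⊗ (u ⊗ v))) refl c (x ^ l) _
      above : ∀ l → k ≤ l → l < k +ℕ (n ∸ k) → low l * x ^ l ≈ 0#
      above l k≤l _ rewrite ≤⇒<ᵇ≡false k≤l = zeroˡ _

    dividedDifference-spec : ∀ d → k ≤ n → ∀ x y →
                             (x - y) * eval n (dividedDifference n k c y) x ≈ trinomial n k c d x - trinomial n k c d y
    dividedDifference-spec d k≤n x y = begin
      (x - y) * eval n (dividedDifference n k c y) x
        ≈⟨ *-congˡ (eval-dividedDifference k≤n x y) ⟩
      (x - y) * (geometric n x y - c * geometric k x y)
        ≈⟨ solve 5 (λ x y c gₙ gₖ → ((x ⊕ ⊝ y) ⊗ (gₙ ⊕ ⊝ (c ⊗ gₖ))) ⊜ ((x ⊕ ⊝ y) ⊗ gₙ ⊕ ⊝ (c ⊗ ((x ⊕ ⊝ y) ⊗ gₖ))))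
                   refl x y c _ _ ⟩
      (x - y) * geometric n x y - c * ((x - y) * geometric k x y)
        ≈⟨ +-cong (geometric-telescope n x y) (-‿cong (*-congˡ (geometric-telescope k x y))) ⟩
      (x ^ n - y ^ n) - c * (x ^ k - y ^ k)
        ≈⟨ solve 6 (λ xⁿ yⁿ xᵏ yᵏ c d →
                      ((xⁿ ⊕ ⊝ yⁿ) ⊕ ⊝ (c ⊗ (xᵏ ⊕ ⊝ yᵏ))) ⊜ (((xⁿ ⊕ ⊝ (c ⊗ xᵏ)) ⊕ ⊝ d) ⊕ ⊝ ((yⁿ ⊕ ⊝ (c ⊗ yᵏ)) ⊕ ⊝ d)))
                   refl _ _ _ _ c d ⟩
      trinomial n k c d x - trinomial n k c d y ∎

    dividedDifference-diagonal : k ≤ n → ∀ y → eval n (dividedDifference n k c y) y ≈ trinomial′ n k c y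
    dividedDifference-diagonal k≤n y = begin
      eval n (dividedDifference n k c y) y
        ≈⟨ eval-dividedDifference k≤n y y ⟩
      geometric n y y - c * geometric k y y
        ≈⟨ +-cong (geometric-diagonal n y) (-‿cong (*-congˡ (geometric-diagonal k y))) ⟩
      n · y ^ (n ∸ 1) - c * (k · y ^ (k ∸ 1))
        ≈⟨ +-cong n·yⁿ⁻¹≈ (-‿cong (trans (×-comm-* k c _) (sym (×-assoc-* k c _)))) ⟩
      trinomial′ n k c y ∎
      where
      n·yⁿ⁻¹≈ : n · y ^ (n ∸ 1) ≈ n · 1# * y ^ (n ∸ 1)
      n·yⁿ⁻¹≈ = trans (×-congʳ n (sym (*-identityˡ _))) (sym (×-assoc-* n 1# _))

    dividedDifference-below : ∀ {l} → l < k → ∀ y → dividedDifference n k c y l ≡ y ^ (n ∸ suc l) - c * y ^ (k ∸ suc l)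
    dividedDifference-below l<k y rewrite <⇒<ᵇ≡true l<k = ≡.refl

    dividedDifference-above : ∀ {l} → k ≤ l → ∀ y → dividedDifference n k c y l ≈ y ^ (n ∸ suc l)
    dividedDifference-above k≤l y rewrite ≤⇒<ᵇ≡false k≤l = trans (+-congˡ -0#≈0#) (+-identityʳ _)

    dividedDifference-top : ∀ {l} → suc l ≡ n → k ≤ l → ∀ y → dividedDifference n k c y l ≈ 1#
    dividedDifference-top {l} ≡.refl k≤l y =
      trans (dividedDifference-above k≤l y) (≡.subst (λ e → y ^ e ≈ 1#) (≡.sym (ℕ.n∸n≡0 l)) refl)

  module _ {e : ℕ} {{e≢0 : NonZero e}} (e-additive : IsAdditivePower e) where

    trinomial-^ : ∀ n k {c d} → c ^ e ≈ c → d ^ e ≈ d → ∀ x →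
                  trinomial n k c d x ^ e ≈ trinomial n k c d (x ^ e)
    trinomial-^ n k {c} {d} cᵉ≈c dᵉ≈d x = begin
      (x ^ n - c * x ^ k - d) ^ e
        ≈⟨ additivePower-- {e} e-additive _ d ⟩
      (x ^ n - c * x ^ k) ^ e - d ^ e
        ≈⟨ +-congʳ (additivePower-- {e} e-additive _ _) ⟩
      (x ^ n) ^ e - (c * x ^ k) ^ e - d ^ e
        ≈⟨ +-cong (+-cong (^-comm-^ x n e) (-‿cong (^-distrib-* c (x ^ k) e))) (-‿cong dᵉ≈d) ⟩
      (x ^ e) ^ n - c ^ e * (x ^ k) ^ e - d
        ≈⟨ +-congʳ (+-congˡ (-‿cong (*-cong cᵉ≈c (^-comm-^ x k e)))) ⟩
      (x ^ e) ^ n - c * (x ^ e) ^ k - d ∎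

module TrinomialDualBasis {a ℓ} (R : CommutativeRing a ℓ) where
  open CommutativeRing R
  open FieldTheory R
  open Sums R
  open Conjugates R
  open Trinomials R
  open AdditivePowers R using (IsAdditivePower; additivePower-^; fixed-^; 0^e≈0)
  open import Algebra.Properties.Semiring.Exp semiring using (^-congˡ; ^-assocʳ; ^-homo-*)
  open import Algebra.Properties.Ring ring using (-0#≈0#; x∙y⁻¹≈ε⇒x≈y)
  open import Relation.Binary.Reasoning.Setoid setoid
  open IntegerCoefficientSolver R using (solve; _⊜_; _⊕_; _⊗_; ⊝_)

  module _ {inv : Carrier → Carrier} (isField : IsField inv)
           {q n : ℕ} {θ : Carrier} {μ : ℕ → Carrier} (dual : IsDualBasis q n (θ ^_) μ)
           {{q≢0 : NonZero q}} (q-additive : IsAdditivePower q)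
           {k : ℕ} {c d : Carrier} (k<n : k < n) (c-fixed : InFq q c) (d-fixed : InFq q d)
           (root : trinomial n k c d θ ≈ 0#) where
    open IsField isField
    open FieldLemmas R isField

    private
      y : ℕ → Carrier
      y = conjugate q θ

      G : ℕ → ℕ → Carrier
      G j = dividedDifference n k c (y j)

      k≤n : k ≤ n
      k≤n = ℕ.<⇒≤ k<n

    trinomial-conjugate : ∀ j → trinomial n k c d (y j) ≈ 0#
    trinomial-conjugate j = begin
      trinomial n k c d (y j)
        ≈⟨ trinomial-^ {{ℕ.m^n≢0 q j}} (additivePower-^ q-additive j) n k (fixed-^ c-fixed j) (fixed-^ d-fixed j) θ ⟨
      trinomial n k c d θ ^ (q ^ℕ j)
        ≈⟨ ^-congˡ (q ^ℕ j) root ⟩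
      0# ^ (q ^ℕ j)
        ≈⟨ 0^e≈0 (q ^ℕ j) {{ℕ.m^n≢0 q j}} ⟩
      0# ∎

    dividedDifference-other-conjugate : ∀ {j j′} → j < n → j′ < n → j′ ≢ j → eval n (G j) (y j′) ≈ 0#
    dividedDifference-other-conjugate {j} {j′} j<n j′<n j′≢j = x*y≈0⇒y≈0 (begin
      (y j′ - y j) * eval n (G j) (y j′)
        ≈⟨ dividedDifference-spec n k c d k≤n (y j′) (y j) ⟩
      trinomial n k c d (y j′) - trinomial n k c d (y j)
        ≈⟨ +-cong (trinomial-conjugate j′) (-‿cong (trinomial-conjugate j)) ⟩
      0# - 0#
        ≈⟨ -‿inverseʳ 0# ⟩
      0# ∎)
      (j′≢j ∘ conjugates-injective dual 1≉0 j′<n j<n ∘ x∙y⁻¹≈ε⇒x≈y _ _)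

    μ-times-derivative : ∀ j l → j < n → l < n → μ l ^ (q ^ℕ j) * trinomial′ n k c (y j) ≈ G j l
    μ-times-derivative j l j<n l<n = sym (begin
      G j l
        ≈⟨ coefficient-via-conjugates dual (G j) l l<n ⟩
      sumFrom 0 n (λ j′ → μ l ^ (q ^ℕ j′) * eval n (G j) (y j′))
        ≈⟨ sumFrom-single 0 n j _ z≤n j<n
           (λ j′ _ j′<n j′≢j → trans (*-congˡ (dividedDifference-other-conjugate j<n j′<n j′≢j)) (zeroʳ _)) ⟩
      μ l ^ (q ^ℕ j) * eval n (G j) (y j)
        ≈⟨ *-congˡ (dividedDifference-diagonal n k c k≤n (y j)) ⟩
      μ l ^ (q ^ℕ j) * trinomial′ n k c (y j) ∎)

    trinomial′-conjugate-nonzero : ∀ j → j < n → ¬ trinomial′ n k c (y j) ≈ 0#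
    trinomial′-conjugate-nonzero j j<n F′≈0 = 1≉0 (begin
      1#
        ≈⟨ dividedDifference-top n k c (ℕ.m+[n∸m]≡n (ℕ.<-≤-trans (s≤s z≤n) j<n)) (<⇒≤∸1 k<n) (y j) ⟨
      G j (n ∸ 1)
        ≈⟨ μ-times-derivative j (n ∸ 1) j<n (n∸1<n j<n) ⟨
      μ (n ∸ 1) ^ (q ^ℕ j) * trinomial′ n k c (y j)
        ≈⟨ *-congˡ F′≈0 ⟩
      μ (n ∸ 1) ^ (q ^ℕ j) * 0#
        ≈⟨ zeroʳ _ ⟩
      0# ∎)

    dual-basis-formula : ∀ j l → j < n → l < n → μ l ^ (q ^ℕ j) ≈ G j l * inv (trinomial′ n k c (y j))
    dual-basis-formula j l j<n l<n = begin
      μ l ^ (q ^ℕ j)                          ≈⟨ *-identityʳ _ ⟨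
      μ l ^ (q ^ℕ j) * 1#                     ≈⟨ *-congˡ (inverse _ (trinomial′-conjugate-nonzero j j<n)) ⟨
      μ l ^ (q ^ℕ j) * (F′ * inv F′)          ≈⟨ *-assoc _ _ _ ⟨
      (μ l ^ (q ^ℕ j) * F′) * inv F′          ≈⟨ *-congʳ (μ-times-derivative j l j<n l<n) ⟩
      G j l * inv F′                          ∎
      where
        F′ : Carrier
        F′ = trinomial′ n k c (y j)

    private
      ^-split : ∀ x a b {e} → a +ℕ b ≡ e → x ^ e ≈ x ^ a * x ^ b
      ^-split x a b ≡.refl = ^-homo-* x a b

      θ^[Q*e] : ∀ j e → θ ^ (q ^ℕ j *ℕ e) ≈ y j ^ e
      θ^[Q*e] j e = sym (^-assocʳ θ (q ^ℕ j) e)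

      θ^[i+Q*e] : ∀ j i e → θ ^ (i +ℕ q ^ℕ j *ℕ e) ≈ θ ^ i * y j ^ e
      θ^[i+Q*e] j i e = trans (^-homo-* θ i _) (*-congˡ (θ^[Q*e] j e))

    derivative : ℕ → Carrier
    derivative j = n · 1# * θ ^ (q ^ℕ j *ℕ (n ∸ 1)) - (k · c) * θ ^ (q ^ℕ j *ℕ (k ∸ 1))

    derivative≈trinomial′ : ∀ j → derivative j ≈ trinomial′ n k c (y j)
    derivative≈trinomial′ j = +-cong (*-congˡ (θ^[Q*e] j _)) (-‿cong (*-congˡ (θ^[Q*e] j _)))

    derivative-nonzero : ∀ j → j < n → ¬ derivative j ≈ 0#
    derivative-nonzero j j<n D≈0 = trinomial′-conjugate-nonzero j j<n (trans (sym (derivative≈trinomial′ j)) D≈0)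

    coefficient≈Σ : ∀ t j → t ≤ n → j < n →
      sumRange t n (λ i → θ ^ i * μ i ^ (q ^ℕ j)) ≈ sumRange t n (λ i → θ ^ i * (G j i * inv (derivative j)))
    coefficient≈Σ t j t≤n j<n = sumRange-cong-on t n t≤n (λ i _ i<n → *-congˡ (trans (dual-basis-formula j i j<n i<n)
      (*-congˡ (inv-cong (trinomial′-conjugate-nonzero j j<n) (sym (derivative≈trinomial′ j))))))

    scale : ℕ → Carrier
    scale j = (- c + θ ^ (q ^ℕ j *ℕ (n ∸ k))) * inv (derivative j)

    term-below : ∀ j i → i < k →
                 θ ^ i * (G j i * inv (derivative j)) ≈ scale j * θ ^ (i +ℕ q ^ℕ j *ℕ (k ∸ i ∸ 1))
    term-below j i i<k = begin
      θ ^ i * (G j i * D⁻¹)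
        ≡⟨ ≡.cong (λ g → θ ^ i * (g * D⁻¹)) (dividedDifference-below n k c i<k (y j)) ⟩
      θ ^ i * ((y j ^ (n ∸ suc i) - c * yᵉ) * D⁻¹)
        ≈⟨ *-congˡ (*-congʳ (+-congʳ (^-split (y j) (n ∸ k) (k ∸ suc i) (∸-telescope i<k k≤n)))) ⟩
      θ ^ i * ((y j ^ (n ∸ k) * yᵉ - c * yᵉ) * D⁻¹)
        ≈⟨ solve 5 (λ θⁱ yⁿ⁻ᵏ yᵉ c D⁻¹ → (θⁱ ⊗ ((yⁿ⁻ᵏ ⊗ yᵉ ⊕ ⊝ (c ⊗ yᵉ)) ⊗ D⁻¹)) ⊜ (((⊝ c ⊕ yⁿ⁻ᵏ) ⊗ D⁻¹) ⊗ (θⁱ ⊗ yᵉ)))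
           refl (θ ^ i) _ yᵉ c D⁻¹ ⟩
      ((- c + y j ^ (n ∸ k)) * D⁻¹) * (θ ^ i * yᵉ)
        ≈⟨ *-cong (*-congʳ (+-congˡ (θ^[Q*e] j (n ∸ k)))) (θ^[i+Q*e] j i (k ∸ suc i)) ⟨
      scale j * θ ^ (i +ℕ q ^ℕ j *ℕ (k ∸ suc i))
        ≡⟨ ≡.cong (λ e → scale j * θ ^ (i +ℕ q ^ℕ j *ℕ e)) (∸-suc-comm k i) ⟨
      scale j * θ ^ (i +ℕ q ^ℕ j *ℕ (k ∸ i ∸ 1)) ∎
      where
      D⁻¹ yᵉ : Carrier
      D⁻¹ = inv (derivative j)
      yᵉ = y j ^ (k ∸ suc i)

    term-above : d ≈ 1# → ∀ j i → k ≤ i → i < n →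
                 θ ^ i * (G j i * inv (derivative j)) ≈ scale j * θ ^ (i +ℕ q ^ℕ j *ℕ (n +ℕ k ∸ i ∸ 1))
    term-above d≈1 j i k≤i i<n = sym (begin
      scale j * θ ^ (i +ℕ q ^ℕ j *ℕ (n +ℕ k ∸ i ∸ 1))
        ≡⟨ ≡.cong (λ e → scale j * θ ^ (i +ℕ q ^ℕ j *ℕ e)) (n+k∸i∸1≡k+n∸[1+i] k i<n) ⟩
      scale j * θ ^ (i +ℕ q ^ℕ j *ℕ (k +ℕ r))
        ≈⟨ *-cong (*-congʳ (+-congˡ (θ^[Q*e] j (n ∸ k)))) (trans (θ^[i+Q*e] j i _) (*-congˡ (^-homo-* (y j) k r))) ⟩
      ((- c + y j ^ (n ∸ k)) * D⁻¹) * (θ ^ i * (y j ^ k * y j ^ r))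
        ≈⟨ solve 6 (λ c yⁿ⁻ᵏ yᵏ yʳ θⁱ D⁻¹ →
           (((⊝ c ⊕ yⁿ⁻ᵏ) ⊗ D⁻¹) ⊗ (θⁱ ⊗ (yᵏ ⊗ yʳ))) ⊜ (θⁱ ⊗ (((yⁿ⁻ᵏ ⊗ yᵏ ⊕ ⊝ (c ⊗ yᵏ)) ⊗ yʳ) ⊗ D⁻¹)))
           refl c _ _ _ _ D⁻¹ ⟩
      θ ^ i * (((y j ^ (n ∸ k) * y j ^ k - c * y j ^ k) * y j ^ r) * D⁻¹)
        ≈⟨ *-congˡ (*-congʳ (trans (*-congʳ yⁿ⁻ᵏyᵏ-cyᵏ≈1) (*-identityˡ _))) ⟩
      θ ^ i * (y j ^ r * D⁻¹)
        ≈⟨ *-congˡ (*-congʳ (dividedDifference-above n k c k≤i (y j))) ⟨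
      θ ^ i * (G j i * D⁻¹) ∎)
      where
      D⁻¹ : Carrier
      D⁻¹ = inv (derivative j)
      r : ℕ
      r = n ∸ suc i
      yⁿ⁻ᵏyᵏ-cyᵏ≈1 : y j ^ (n ∸ k) * y j ^ k - c * y j ^ k ≈ 1#
      yⁿ⁻ᵏyᵏ-cyᵏ≈1 = trans (+-congʳ (sym (^-split (y j) (n ∸ k) k (ℕ.m∸n+n≡m k≤n))))
                            (trans (x∙y⁻¹≈ε⇒x≈y _ _ (trinomial-conjugate j)) d≈1)

    coefficient-below : d ≈ 1# → ∀ t j → t < k → j < n →
      sumRange t n (λ i → θ ^ i * μ i ^ (q ^ℕ j)) ≈
      scale j * (sumRange t k (λ i → θ ^ (i +ℕ q ^ℕ j *ℕ (k ∸ i ∸ 1))) +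
                 sumRange k n (λ i → θ ^ (i +ℕ q ^ℕ j *ℕ (n +ℕ k ∸ i ∸ 1))))
    coefficient-below d≈1 t j t<k j<n = begin
      sumRange t n (λ i → θ ^ i * μ i ^ (q ^ℕ j))
        ≈⟨ coefficient≈Σ t j (ℕ.<⇒≤ (ℕ.<-trans t<k k<n)) j<n ⟩
      sumRange t n term
        ≈⟨ sumRange-split t k n term (ℕ.<⇒≤ t<k) k≤n ⟩
      sumRange t k term + sumRange k n term
        ≈⟨ +-cong (sumRange-cong-on t k (ℕ.<⇒≤ t<k) (λ i _ i<k → term-below j i i<k))
           (sumRange-cong-on k n k≤n (λ i k≤i i<n → term-above d≈1 j i k≤i i<n)) ⟩
      sumRange t k (λ i → scale j * θ ^ (i +ℕ q ^ℕ j *ℕ (k ∸ i ∸ 1))) +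
      sumRange k n (λ i → scale j * θ ^ (i +ℕ q ^ℕ j *ℕ (n +ℕ k ∸ i ∸ 1)))
        ≈⟨ +-cong (*-distribˡ-sumFrom (scale j) t (k ∸ t) _) (*-distribˡ-sumFrom (scale j) k (n ∸ k) _) ⟨
      scale j * sumRange t k _ + scale j * sumRange k n _
        ≈⟨ distribˡ (scale j) _ _ ⟨
      scale j * (sumRange t k (λ i → θ ^ (i +ℕ q ^ℕ j *ℕ (k ∸ i ∸ 1))) +
                 sumRange k n (λ i → θ ^ (i +ℕ q ^ℕ j *ℕ (n +ℕ k ∸ i ∸ 1)))) ∎
      where
      term : ℕ → Carrier
      term i = θ ^ i * (G j i * inv (derivative j))

    coefficient-above : d ≈ 1# → ∀ t j → k ≤ t → t ≤ n → j < n →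
      sumRange t n (λ i → θ ^ i * μ i ^ (q ^ℕ j)) ≈ scale j * sumRange t n (λ i → θ ^ (i +ℕ q ^ℕ j *ℕ (n +ℕ k ∸ i ∸ 1)))
    coefficient-above d≈1 t j k≤t t≤n j<n = begin
      sumRange t n (λ i → θ ^ i * μ i ^ (q ^ℕ j))
        ≈⟨ coefficient≈Σ t j t≤n j<n ⟩
      sumRange t n (λ i → θ ^ i * (G j i * inv (derivative j)))
        ≈⟨ sumRange-cong-on t n t≤n (λ i t≤i i<n → term-above d≈1 j i (ℕ.≤-trans k≤t t≤i) i<n) ⟩
      sumRange t n (λ i → scale j * θ ^ (i +ℕ q ^ℕ j *ℕ (n +ℕ k ∸ i ∸ 1)))
        ≈⟨ *-distribˡ-sumFrom (scale j) t (n ∸ t) _ ⟨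
      scale j * sumRange t n (λ i → θ ^ (i +ℕ q ^ℕ j *ℕ (n +ℕ k ∸ i ∸ 1))) ∎

    coefficient-binomial : k ≡ 1 → c ≈ 0# → ∀ t j → t ≤ n → j < n →
      sumRange t n (λ i → θ ^ i * μ i ^ (q ^ℕ j)) ≈ inv (n · 1#) * sumRange t n (λ i → inv (θ ^ (i *ℕ (q ^ℕ j ∸ 1))))
    coefficient-binomial ≡.refl c≈0 t j t≤n j<n = begin
      sumRange t n (λ i → θ ^ i * μ i ^ (q ^ℕ j))
        ≈⟨ coefficient≈Σ t j t≤n j<n ⟩
      sumRange t n (λ i → θ ^ i * (G j i * inv (derivative j)))
        ≈⟨ sumRange-cong-on t n t≤n (λ i _ i<n → term i i<n) ⟩
      sumRange t n (λ i → inv N * inv (θ ^ (i *ℕ (q ^ℕ j ∸ 1))))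
        ≈⟨ *-distribˡ-sumFrom (inv N) t (n ∸ t) _ ⟨
      inv N * sumRange t n (λ i → inv (θ ^ (i *ℕ (q ^ℕ j ∸ 1)))) ∎
      where
      N Y : Carrier
      N = n · 1#
      Y = y j ^ (n ∸ 1)
      D≈N*Y : derivative j ≈ N * Y
      D≈N*Y = trans (+-cong (*-congˡ (θ^[Q*e] j _)) (-‿cong (trans (*-congʳ (trans (+-identityʳ c) c≈0)) (zeroˡ _))))
                    (trans (+-congˡ -0#≈0#) (+-identityʳ _))
      N*Y≉0 : ¬ N * Y ≈ 0#
      N*Y≉0 = derivative-nonzero j j<n ∘ trans D≈N*Y
      N≉0 : ¬ N ≈ 0#
      N≉0 N≈0 = N*Y≉0 (trans (*-congʳ N≈0) (zeroˡ Y))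
      Y≉0 : ¬ Y ≈ 0#
      Y≉0 Y≈0 = N*Y≉0 (trans (*-congˡ Y≈0) (zeroʳ N))
      Gᵢ≈ : ∀ i → G j i ≈ y j ^ (n ∸ suc i)
      Gᵢ≈ i = trans (+-congˡ (trans (-‿cong (low≈0 (i <ᵇ 1))) -0#≈0#)) (+-identityʳ _)
        where
        low≈0 : ∀ b → (if b then c * y j ^ (1 ∸ suc i) else 0#) ≈ 0#
        low≈0 true  = trans (*-congʳ c≈0) (zeroˡ _)
        low≈0 false = refl
      θⁱ*yʳ*Y⁻¹≈ : ∀ i → i < n → θ ^ i * (y j ^ (n ∸ suc i) * inv Y) ≈ inv (θ ^ (i *ℕ (q ^ℕ j ∸ 1)))
      θⁱ*yʳ*Y⁻¹≈ i i<n = inverse-unique W≉0 W*θⁱ*yʳ*Y⁻¹≈1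
        where
        W : Carrier
        W = θ ^ (i *ℕ (q ^ℕ j ∸ 1))
        r : ℕ
        r = n ∸ suc i
        W*θⁱ≈yⁱ : W * θ ^ i ≈ y j ^ i
        W*θⁱ≈yⁱ = trans (sym (^-split θ (i *ℕ (q ^ℕ j ∸ 1)) i (i*[m∸1]+i≡m*i i (q ^ℕ j) {{ℕ.m^n≢0 q j}}))) (θ^[Q*e] j i)
        W*θⁱ*yʳ*Y⁻¹≈1 : W * (θ ^ i * (y j ^ r * inv Y)) ≈ 1#
        W*θⁱ*yʳ*Y⁻¹≈1 = begin
          W * (θ ^ i * (y j ^ r * inv Y)) ≈⟨ *-assoc _ _ _ ⟨
          (W * θ ^ i) * (y j ^ r * inv Y) ≈⟨ *-congʳ W*θⁱ≈yⁱ ⟩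
          y j ^ i * (y j ^ r * inv Y)     ≈⟨ *-assoc _ _ _ ⟨
          (y j ^ i * y j ^ r) * inv Y     ≈⟨ *-congʳ (^-split (y j) i r (i+[n∸[1+i]]≡n∸1 i<n)) ⟨
          Y * inv Y                       ≈⟨ inverse Y Y≉0 ⟩
          1#                              ∎
        W≉0 : ¬ W ≈ 0#
        W≉0 W≈0 = 1≉0 (trans (sym W*θⁱ*yʳ*Y⁻¹≈1) (trans (*-congʳ W≈0) (zeroˡ _)))
      term : ∀ i → i < n → θ ^ i * (G j i * inv (derivative j)) ≈ inv N * inv (θ ^ (i *ℕ (q ^ℕ j ∸ 1)))
      term i i<n = begin
        θ ^ i * (G j i * inv (derivative j))
          ≈⟨ *-congˡ (*-cong (Gᵢ≈ i) (trans (inv-cong (derivative-nonzero j j<n) D≈N*Y) (inv-distrib-* N≉0 Y≉0))) ⟩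
        θ ^ i * (y j ^ (n ∸ suc i) * (inv N * inv Y))
          ≈⟨ solve 4 (λ a b c d → (a ⊗ (b ⊗ (c ⊗ d))) ⊜ (c ⊗ (a ⊗ (b ⊗ d)))) refl (θ ^ i) _ (inv N) (inv Y) ⟩
        inv N * (θ ^ i * (y j ^ (n ∸ suc i) * inv Y))
          ≈⟨ *-congˡ (θⁱ*yʳ*Y⁻¹≈ i i<n) ⟩
        inv N * inv (θ ^ (i *ℕ (q ^ℕ j ∸ 1))) ∎

module MinimalPolynomials {a ℓ} (R : CommutativeRing a ℓ) where
  open CommutativeRing R
  open FieldTheory R
  open Sums R
  open Trinomials R using (trinomial)
  open AdditivePowers R using (IsAdditivePower; fixed-neg⇒fixed)
  open import Algebra.Properties.Ring ring using (-0#≈0#)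
  open import Relation.Binary.Reasoning.Setoid setoid
  open IntegerCoefficientSolver R using (solve; _⊜_; _⊕_; _⊗_; ⊝_)

  trinomialCoeffs-at-k : ∀ c {k} → k ≢ 0 → trinomialCoeffs c k k ≡ - c
  trinomialCoeffs-at-k c {k} k≢0 rewrite ≢⇒≡ᵇ≡false k≢0 | ≡ᵇ-refl k = ≡.refl

  module _ {n : ℕ} (0<n : 0 < n) (θ : Carrier) where

    Σ-binomialCoeffs : ∀ d → sumRange 0 n (λ i → binomialCoeffs d i * θ ^ i) ≈ - d
    Σ-binomialCoeffs d = trans (sumFrom-single 0 n 0 _ z≤n 0<n higher≈0) (*-identityʳ (- d))
      where
      higher≈0 : ∀ i → 0 ≤ i → i < n → i ≢ 0 → binomialCoeffs d i * θ ^ i ≈ 0#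
      higher≈0 zero    _ _ 0≢0 = contradiction ≡.refl 0≢0
      higher≈0 (suc i) _ _ _   = zeroˡ _

    Σ-trinomialCoeffs : ∀ c {k} → k ≢ 0 → k < n →
                        sumRange 0 n (λ i → trinomialCoeffs c k i * θ ^ i) ≈ - 1# + - c * θ ^ k
    Σ-trinomialCoeffs c {k} k≢0 k<n = begin
      sumRange 0 n (λ i → trinomialCoeffs c k i * θ ^ i)
        ≈⟨ sumFrom-cong 0 n split ⟩
      sumRange 0 n (λ i → binomialCoeffs 1# i * θ ^ i + v i)
        ≈⟨ sumFrom-distrib-+ 0 n _ v ⟩
      sumRange 0 n (λ i → binomialCoeffs 1# i * θ ^ i) + sumRange 0 n v
        ≈⟨ +-cong (Σ-binomialCoeffs 1#) (sumFrom-single 0 n k v z≤n k<n v-off) ⟩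
      - 1# + v k
        ≡⟨ ≡.cong (λ b → - 1# + (if b then - c else 0#) * θ ^ k) (≡ᵇ-refl k) ⟩
      - 1# + - c * θ ^ k ∎
      where
      v : ℕ → Carrier
      v i = (if i ≡ᵇ k then - c else 0#) * θ ^ i
      v-off : ∀ i → 0 ≤ i → i < n → i ≢ k → v i ≈ 0#
      v-off i _ _ i≢k rewrite ≢⇒≡ᵇ≡false i≢k = zeroˡ _
      split : ∀ i → trinomialCoeffs c k i * θ ^ i ≈ binomialCoeffs 1# i * θ ^ i + v i
      split zero    rewrite ≢⇒≡ᵇ≡false (k≢0 ∘ ≡.sym) = sym (trans (+-congˡ (zeroˡ _)) (+-identityʳ _))
      split (suc i) = sym (trans (+-congʳ (zeroˡ _)) (+-identityˡ _))

  module _ {q : ℕ} {{q≢0 : NonZero q}} (q-additive : IsAdditivePower q) {n : ℕ} (0<n : 0 < n) {θ : Carrier} where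

    binomial-minimal : ∀ {d} → IsMinimalPolynomial q n θ (binomialCoeffs d) → InFq q d × trinomial n 1 0# d θ ≈ 0#
    binomial-minimal {d} (coeffs∈Fq , root , _) = fixed-neg⇒fixed q-additive (coeffs∈Fq 0 0<n) , (begin
      θ ^ n - 0# * θ ^ 1 - d     ≈⟨ +-congʳ (trans (+-congˡ (trans (-‿cong (zeroˡ _)) -0#≈0#)) (+-identityʳ _)) ⟩
      θ ^ n - d                  ≈⟨ +-congˡ (Σ-binomialCoeffs 0<n θ d) ⟨
      θ ^ n + sumRange 0 n _     ≈⟨ root ⟩
      0#                         ∎)

    trinomial-minimal : ∀ {c k} → 1 ≤ k → k < n → IsMinimalPolynomial q n θ (trinomialCoeffs c k) →
                        InFq q c × trinomial n k c 1# θ ≈ 0#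
    trinomial-minimal {c} {k} 1≤k k<n (coeffs∈Fq , root , _) =
      fixed-neg⇒fixed q-additive (≡.subst (InFq q) (trinomialCoeffs-at-k c k≢0) (coeffs∈Fq k k<n)) , (begin
        θ ^ n - c * θ ^ k - 1#         ≈⟨ solve 4 (λ θⁿ c θᵏ o → ((θⁿ ⊕ ⊝ (c ⊗ θᵏ)) ⊕ ⊝ o) ⊜ (θⁿ ⊕ (⊝ o ⊕ ⊝ c ⊗ θᵏ)))
                                             refl (θ ^ n) c (θ ^ k) 1# ⟩
        θ ^ n + (- 1# + - c * θ ^ k)   ≈⟨ +-congˡ (Σ-trinomialCoeffs 0<n θ c k≢0 k<n) ⟨
        θ ^ n + sumRange 0 n _         ≈⟨ root ⟩
        0#                             ∎)
      where
      k≢0 : k ≢ 0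
      k≢0 = ℕ.n>0⇒n≢0 1≤k

corollary5p3 : ∀ {a ℓ} (R : CommutativeRing a ℓ) →
    let open CommutativeRing R
        open FieldTheory R
    in (inv : Carrier → Carrier) → IsField inv →
       (q n : ℕ) → 2 ≤ q → HasCard (q ^ℕ n) →
       (θ : Carrier) → ¬ InFq q θ →
       (t : ℕ) → 1 ≤ t → t < n →
       (μ : ℕ → Carrier) → IsDualBasis q n (θ ^_) μ →
       -- (1) minimal polynomial x^n - d
       ((d : Carrier) → IsMinimalPolynomial q n θ (binomialCoeffs d) →
          ∀ x → pPoly q n t θ μ x ≈
            linPoly q n (λ j → inv (n · 1#) *
              sumRange t n (λ i → inv (θ ^ (i *ℕ (q ^ℕ j ∸ 1))))) x)
       ×
       -- (2) minimal polynomial x^n - c x^k - 1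
       ((c : Carrier) (k : ℕ) → 1 ≤ k → k < n →
          IsMinimalPolynomial q n θ (trinomialCoeffs c k) →
          (t < k → ∀ x → pPoly q n t θ μ x ≈
            linPoly q n (λ j →
              ((- c + θ ^ (q ^ℕ j *ℕ (n ∸ k))) *
                inv (n · 1# * θ ^ (q ^ℕ j *ℕ (n ∸ 1)) - (k · c) * θ ^ (q ^ℕ j *ℕ (k ∸ 1)))) *
              (sumRange t k (λ i → θ ^ (i +ℕ q ^ℕ j *ℕ (k ∸ i ∸ 1))) +
               sumRange k n (λ i → θ ^ (i +ℕ q ^ℕ j *ℕ (n +ℕ k ∸ i ∸ 1))))) x)
          ×
          (k ≤ t → ∀ x → pPoly q n t θ μ x ≈
            linPoly q n (λ j →
              ((- c + θ ^ (q ^ℕ j *ℕ (n ∸ k))) *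
                inv (n · 1# * θ ^ (q ^ℕ j *ℕ (n ∸ 1)) - (k · c) * θ ^ (q ^ℕ j *ℕ (k ∸ 1)))) *
              sumRange t n (λ i → θ ^ (i +ℕ q ^ℕ j *ℕ (n +ℕ k ∸ i ∸ 1)))) x))
corollary5p3 R inv isField q n 2≤q card θ _ t 1≤t t<n μ dual =
    (λ d minimal → let (d∈Fq , root) = binomial-minimal q-additive 0<n minimal in
      pPoly≈linPoly q n t θ μ _ (λ j j<n → coefficient-binomial isField dual q-additive
        (ℕ.≤-<-trans 1≤t t<n) (0^e≈0 q) d∈Fq root ≡.refl refl t j (ℕ.<⇒≤ t<n) j<n))
  , (λ c k 1≤k k<n minimal → let (c∈Fq , root) = trinomial-minimal q-additive 0<n 1≤k k<n minimal in
        (λ t<k → pPoly≈linPoly q n t θ μ _ (λ j j<n → coefficient-below isField dual q-additive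
          k<n c∈Fq (1^e≈1 q) root refl t j t<k j<n))
      , (λ k≤t → pPoly≈linPoly q n t θ μ _ (λ j j<n → coefficient-above isField dual q-additive
          k<n c∈Fq (1^e≈1 q) root refl t j k≤t (ℕ.<⇒≤ t<n) j<n)))
  where
  -- The ignored hypothesis θ ∉ F_q follows from the minimal-polynomial hypotheses.
  open CommutativeRing R
  open AdditivePowers R using (IsAdditivePower; 0^e≈0; 1^e≈1)
  open Conjugates R using (pPoly≈linPoly)
  open MinimalPolynomials R using (binomial-minimal; trinomial-minimal)
  open TrinomialDualBasis R using (coefficient-binomial; coefficient-below; coefficient-above)

  0<n : 0 < n
  0<n = ℕ.<-≤-trans (s≤s z≤n) t<n

  instance
    q≢0 : NonZero q
    q≢0 = ℕ.>-nonZero (ℕ.<-≤-trans (s≤s z≤n) 2≤q)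
    n≢0 : NonZero n
    n≢0 = ℕ.>-nonZero 0<n

  q-additive : IsAdditivePower q
  q-additive = FiniteRing.frobenius-additive R isField card
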